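{- Let $n\ge 2$ and let $g$ be a nonnegative integer with $\gcd(n,g)=1$. For a sequence $(x_m)_{m\ge0}$ let $C_{n,g}(x)$ denote the $n\times n$ matrix with $(i,j)$ entry ($0\le i,j\le n-1$) equal to $x_{((j-ig)\bmod n)+1}$, and let $Q_g$ be the $n\times n$ matrix with $(i,j)$ entry $1$ if $j\equiv ig\pmod n$ and $0$ otherwise. Then: (1) for the Fibonacci numbers ($F_0=0,F_1=1,F_{m+2}=F_{m+1}+F_m$), $\det C_{n,g}(F)=\det Q_g\cdot\left[(1-F_{n+1})^{n-1}+F_n^{n-2}\sum_{i=1}^{n-1}F_i\left(\frac{1-F_{n+1}}{F_n}\right)^{i-1}\right]$; (2) for the Lucas numbers ($L_0=2,L_1=1,L_{m+2}=L_{m+1}+L_m$), $\det C_{n,g}(L)=\det Q_g\cdot\left[(1-L_{n+1})^{n-1}+(L_n-2)^{n-2}\sum_{i=1}^{n-1}(L_{i+2}-3L_{i+1})\left(\frac{1-L_{n+1}}{L_n-2}\right)^{i-1}\right]$; (3) for the Pell numbers ($P_0=0,P_1=1,P_{m+2}=2P_{m+1}+P_m$), $\det C_{n,g}(P)=\det Q_g\cdot\left[(1-P_{n+1})^{n-1}+P_n^{n-2}\sum_{i=1}^{n-1}P_i\left(\frac{1-P_{n+1}}{P_n}\right)^{i-1}\right]$; (4) for the Jacobsthal numbers ($J_0=0,J_1=1,J_{m+2}=J_{m+1}+2J_m$), $\det C_{n,g}(J)=\det Q_g\cdot\left[(1-J_{n+1})^{n-1}+2^{n-1}J_n^{n-2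}\sum_{i=1}^{n-1}J_i\left(\frac{1-J_{n+1}}{2J_n}\right)^{i-1}\right]$.
   Context: $C_{n,g}(x)$ is the $g$-circulant matrix with first row $(x_1,\ldots,x_n)$ (each row is the previous row circularly shifted right by $g$ positions), and $Q_g$ is the $g$-circulant matrix with first row $(1,0,\ldots,0)$. -}

module Defs where

open import Data.Nat as ℕ using (ℕ; zero; suc)
open import Data.Integer using (ℤ; +_; _+_; _-_; _*_; -_; _^_; _%ℕ_)
open import Relation.Nullary using (yes; no)
open import Data.Fin using (Fin; zero; suc; toℕ; punchIn)

Matrix : ℕ → Set
Matrix n = Fin n → Fin n → ℤ

sumFin : ∀ {n} → (Fin n → ℤ) → ℤ
sumFin {zero}  f = + 0
sumFin {suc n} f = f zero + sumFin (λ i → f (suc i))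

sum1to : ℕ → (ℕ → ℤ) → ℤ
sum1to zero    f = + 0
sum1to (suc m) f = sum1to m f + f (suc m)

det : ∀ n → Matrix n → ℤ
det zero    A = + 1
det (suc n) A =
  sumFin (λ j → ((- + 1) ^ toℕ j) * A zero j * det n (λ i k → A (suc i) (punchIn j k)))

-- x mod n as a natural number in [0, n) (only used with n ≥ 1)
modN : ℤ → ℕ → ℕ
modN x zero    = 0
modN x (suc m) = x %ℕ suc m

Cg : (n g : ℕ) → (ℕ → ℤ) → Matrix n
Cg n g x i j = x (suc (modN (+ toℕ j - (+ toℕ i) * (+ g)) n))

Qg : (n g : ℕ) → Matrix n
Qg n g i j with modN (+ toℕ j - (+ toℕ i) * (+ g)) n ℕ.≟ 0
... | yes _ = + 1
... | no  _ = + 0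

fib : ℕ → ℤ
fib zero          = + 0
fib (suc zero)    = + 1
fib (suc (suc m)) = fib (suc m) + fib m

lucas : ℕ → ℤ
lucas zero          = + 2
lucas (suc zero)    = + 1
lucas (suc (suc m)) = lucas (suc m) + lucas m

pell : ℕ → ℤ
pell zero          = + 0
pell (suc zero)    = + 1
pell (suc (suc m)) = + 2 * pell (suc m) + pell m

jacobsthal : ℕ → ℤ
jacobsthal zero          = + 0
jacobsthal (suc zero)    = + 1
jacobsthal (suc (suc m)) = jacobsthal (suc m) + + 2 * jacobsthal m

-- 1. A toolkit for the first-row Laplace expansion `det` of Defs: expansion
--    along the first column, invariance under transposition, linearity in a
--    column, vanishing on two equal columns, sign change under a column
--    swap, invariance under adding a multiple of a column, and: reindexing
--    the rows by any σ : Fin n → Fin n multiplies det by det (I ∘ σ).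
-- 2. Row i of C_{n,g}(x) is row (i g mod n) of the ordinary circulant
--    C_{n,1}(x), and Q_g is I reindexed the same way, so
--    det C_{n,g}(x) = det Q_g · det C_{n,1}(x).
-- 3. If x_{m+2} = p x_{m+1} + q x_m, subtracting p·col(j-1) + q·col(j-2)
--    from each column j ≥ 2 of C_{n,1}(x) leaves two full columns and a
--    bidiagonal band.  Expanding along the first row gives the closed form
--      det C_{n,1}(x) = x₁ αⁿ⁻¹ + Σ_{i=1}^{n-1} (x₁ x_{i+2} - x₂ x_{i+1}) αⁱ⁻¹ βⁿ⁻¹⁻ⁱ
--    with α = x₁ - x_{n+1} and β = q xₙ + p x₁ - x₂ (Recurrence.det-Cg-formula).
-- 4. The four parts of the corollary are the instances (x₁ = 1 in each case)
--    after simplifying the coefficients and β.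
module Submission where

open import Defs
open import Data.Nat using (ℕ; _≤_; _∸_)
open import Data.Nat.GCD using (gcd)
open import Data.Integer using (ℤ; +_; _+_; _-_; _*_; _^_)
open import Data.Product using (_×_)
open import Relation.Binary.PropositionalEquality using (_≡_)

import Data.Nat as ℕ
import Data.Nat.Properties as ℕP
open import Data.Nat using (zero; suc; z≤n; s≤s)
open import Data.Integer using (-_; -[1+_]; _%ℕ_; _/ℕ_)
import Data.Nat.DivMod as ND
open import Data.Integer.DivMod using (a≡a%ℕn+[a/ℕn]*n; n%ℕd<d)
open import Data.Integer.Properties using (+-comm; *-zeroʳ; *-zeroˡ; +-identityʳ; +-identityˡ; *-identityˡ; *-identityʳ; neg-involutive; +-injective; pos-+; pos-*)
open import Data.Integer.Tactic.RingSolver using (solve-∀)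
open import Data.Fin using (Fin; zero; suc; toℕ; punchIn; punchOut; inject₁; fromℕ<)
open import Data.Fin.Properties using (punchOut-punchIn; punchIn-punchOut; punchInᵢ≢i; toℕ-injective; punchOut-cong; toℕ-inject₁; any?; pigeonhole; punchOut-injective; toℕ-fromℕ<; toℕ<n; suc-injective) renaming (_≟_ to _≟F_)
open import Data.Fin.Permutation.Components using (transpose; transpose-inverse)
open import Relation.Binary.PropositionalEquality using (refl; sym; trans; cong; cong₂; subst; subst₂; _≢_; module ≡-Reasoning)
open import Relation.Nullary using (yes; no; ¬_; Dec)
open import Relation.Nullary.Decidable using (dec-true; dec-false)
open import Data.Empty using (⊥-elim)
open import Data.Product using (Σ; _,_; ∃; proj₁; proj₂)
open import Data.Sum using (inj₁; inj₂)
open import Function using (_∘_)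
open import Relation.Binary.Definitions using (tri<; tri≈; tri>)

sumFin-cong : ∀ {n} {f g : Fin n → ℤ} → (∀ i → f i ≡ g i) → sumFin f ≡ sumFin g
sumFin-cong {zero}  h = refl
sumFin-cong {suc n} h = cong₂ _+_ (h zero) (sumFin-cong (h ∘ suc))

sumFin-+ : ∀ {n} (f g : Fin n → ℤ) → sumFin (λ i → f i + g i) ≡ sumFin f + sumFin g
sumFin-+ {zero}  f g = refl
sumFin-+ {suc n} f g =
  trans (cong (_+_ (f zero + g zero)) (sumFin-+ (f ∘ suc) (g ∘ suc))) (interchange (f zero) (g zero) _ _)
  where
  interchange : ∀ a b c d → a + b + (c + d) ≡ a + c + (b + d)
  interchange = solve-∀

sumFin-*ˡ : ∀ {n} (c : ℤ) (f : Fin n → ℤ) → sumFin (λ i → c * f i) ≡ c * sumFin f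
sumFin-*ˡ {zero}  c f = sym (*-zeroʳ c)
sumFin-*ˡ {suc n} c f = trans (cong (_+_ (c * f zero)) (sumFin-*ˡ c (f ∘ suc))) (distrib c (f zero) _)
  where
  distrib : ∀ a b d → a * b + a * d ≡ a * (b + d)
  distrib = solve-∀

sumFin-zero : ∀ {n} (f : Fin n → ℤ) → (∀ i → f i ≡ + 0) → sumFin f ≡ + 0
sumFin-zero {zero}  f h = refl
sumFin-zero {suc n} f h = cong₂ _+_ (h zero) (sumFin-zero (f ∘ suc) (h ∘ suc))

sumFin-swap : ∀ {m n} (f : Fin m → Fin n → ℤ) →
  sumFin (λ i → sumFin (f i)) ≡ sumFin (λ j → sumFin (λ i → f i j))
sumFin-swap {zero}  {n} f = sym (sumFin-zero {n} (λ j → + 0) (λ j → refl))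
sumFin-swap {suc m} {n} f =
  trans (cong (_+_ (sumFin (f zero))) (sumFin-swap (f ∘ suc)))
        (sym (sumFin-+ (f zero) (λ j → sumFin (λ i → f (suc i) j))))

sumFin-single : ∀ {n} (f : Fin n → ℤ) (c : Fin n) → (∀ j → j ≢ c → f j ≡ + 0) → sumFin f ≡ f c
sumFin-single f zero h =
  trans (cong (_+_ (f zero)) (sumFin-zero (f ∘ suc) (λ i → h (suc i) (λ ())))) (+-identityʳ (f zero))
sumFin-single f (suc c) h =
  trans (cong₂ _+_ (h zero (λ ())) (sumFin-single (f ∘ suc) c (λ j j≢c → h (suc j) (j≢c ∘ suc-injective))))
        (+-identityˡ (f (suc c)))

sumFin-pair : ∀ {n} (f : Fin n → ℤ) (c d : Fin n) → c ≢ d →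
  (∀ j → j ≢ c → j ≢ d → f j ≡ + 0) → sumFin f ≡ f c + f d
sumFin-pair f zero    zero    c≢d h = ⊥-elim (c≢d refl)
sumFin-pair f zero    (suc d) c≢d h =
  cong (_+_ (f zero)) (sumFin-single (f ∘ suc) d (λ j j≢d → h (suc j) (λ ()) (j≢d ∘ suc-injective)))
sumFin-pair f (suc c) zero    c≢d h =
  trans (sumFin-pair f zero (suc c) (λ ()) (λ j j≢0 j≢c → h j j≢c j≢0)) (+-comm (f zero) (f (suc c)))
sumFin-pair f (suc c) (suc d) c≢d h =
  trans (cong₂ _+_ (h zero (λ ()) (λ ()))
                   (sumFin-pair (f ∘ suc) c d (c≢d ∘ cong suc)
                      (λ j j≢c j≢d → h (suc j) (j≢c ∘ suc-injective) (j≢d ∘ suc-injective))))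
        (+-identityˡ _)

sum1to-cong : ∀ k (f g : ℕ → ℤ) → (∀ i → suc i ≤ k → f (suc i) ≡ g (suc i)) → sum1to k f ≡ sum1to k g
sum1to-cong zero    f g h = refl
sum1to-cong (suc k) f g h = cong₂ _+_ (sum1to-cong k f g (λ i i<k → h i (ℕP.m≤n⇒m≤1+n i<k))) (h k ℕP.≤-refl)

sum1to-*ˡ : ∀ k (c : ℤ) (f : ℕ → ℤ) → sum1to k (λ i → c * f i) ≡ c * sum1to k f
sum1to-*ˡ zero    c f = sym (*-zeroʳ c)
sum1to-*ˡ (suc k) c f = trans (cong (_+ c * f (suc k)) (sum1to-*ˡ k c f)) (distrib c (sum1to k f) (f (suc k)))
  where
  distrib : ∀ c a b → c * a + c * b ≡ c * (a + b)
  distrib = solve-∀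

sgn : ℕ → ℤ
sgn k = (- + 1) ^ k

minor₀ : ∀ {n} → Matrix (suc n) → Fin (suc n) → Matrix n
minor₀ A j i k = A (suc i) (punchIn j k)

rowTerm : ∀ {n} → Matrix (suc n) → Fin (suc n) → ℤ
rowTerm {n} A j = sgn (toℕ j) * A zero j * det n (minor₀ A j)

det-cong : ∀ n {A B : Matrix n} → (∀ i j → A i j ≡ B i j) → det n A ≡ det n B
det-cong zero    h = refl
det-cong (suc n) h = sumFin-cong λ j →
  cong₂ _*_ (cong (sgn (toℕ j) *_) (h zero j)) (det-cong n (λ i k → h (suc i) (punchIn j k)))

-- Expansion along the first column, proved by expanding both first row and
-- first column one level deeper and exchanging the two sums.
det-expand-col₀ : ∀ m (A : Matrix (suc m)) →
  det (suc m) A ≡ sumFin (λ i → sgn (toℕ i) * A i zero * det m (λ r k → A (punchIn i r) (suc k)))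
det-expand-col₀ zero    A = refl
det-expand-col₀ (suc m) A = cong (_+_ (rowTerm A zero)) (begin
  sumFin (λ j → sgn (suc (toℕ j)) * A zero (suc j) * det (suc m) (minor₀ A (suc j)))
    ≡⟨ sumFin-cong (λ j → cong (sgn (suc (toℕ j)) * A zero (suc j) *_) (det-expand-col₀ m (minor₀ A (suc j)))) ⟩
  sumFin (λ j → sgn (suc (toℕ j)) * A zero (suc j) * sumFin (λ i → sgn (toℕ i) * A (suc i) zero * D i j))
    ≡⟨ sumFin-cong (λ j → sym (sumFin-*ˡ (sgn (suc (toℕ j)) * A zero (suc j)) (λ i → sgn (toℕ i) * A (suc i) zero * D i j))) ⟩
  sumFin (λ j → sumFin (λ i → sgn (suc (toℕ j)) * A zero (suc j) * (sgn (toℕ i) * A (suc i) zero * D i j)))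
    ≡⟨ sumFin-swap (λ j i → sgn (suc (toℕ j)) * A zero (suc j) * (sgn (toℕ i) * A (suc i) zero * D i j)) ⟩
  sumFin (λ i → sumFin (λ j → sgn (suc (toℕ j)) * A zero (suc j) * (sgn (toℕ i) * A (suc i) zero * D i j)))
    ≡⟨ sumFin-cong (λ i → sumFin-cong (λ j → regroup (sgn (toℕ j)) (A zero (suc j)) (sgn (toℕ i)) (A (suc i) zero) (D i j))) ⟩
  sumFin (λ i → sumFin (λ j → sgn (suc (toℕ i)) * A (suc i) zero * (sgn (toℕ j) * A zero (suc j) * D i j)))
    ≡⟨ sumFin-cong (λ i → sumFin-*ˡ (sgn (suc (toℕ i)) * A (suc i) zero) (λ j → sgn (toℕ j) * A zero (suc j) * D i j)) ⟩
  sumFin (λ i → sgn (suc (toℕ i)) * A (suc i) zero * sumFin (λ j → sgn (toℕ j) * A zero (suc j) * D i j)) ∎)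
  where
  open ≡-Reasoning
  D : Fin (suc m) → Fin (suc m) → ℤ
  D i j = det m (λ r k → A (suc (punchIn i r)) (suc (punchIn j k)))
  regroup : ∀ sj a si b d → - + 1 * sj * a * (si * b * d) ≡ - + 1 * si * b * (sj * a * d)
  regroup = solve-∀

-- det Aᵀ = det A: the first-row expansion of Aᵀ is the first-column expansion of A.
transposeM : ∀ {n} → Matrix n → Matrix n
transposeM A i j = A j i

det-transpose : ∀ n (A : Matrix n) → det n (transposeM A) ≡ det n A
det-transpose zero    A = refl
det-transpose (suc n) A = trans
  (sumFin-cong (λ j → cong (sgn (toℕ j) * A j zero *_) (det-transpose n (λ k r → A (punchIn j k) (suc r)))))
  (sym (det-expand-col₀ n A))

toℕ-punchIn-< : ∀ {n} (i : Fin (suc n)) (j : Fin n) → toℕ j ℕ.< toℕ i → toℕ (punchIn i j) ≡ toℕ j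
toℕ-punchIn-< (suc i) zero    _         = refl
toℕ-punchIn-< (suc i) (suc j) (s≤s j<i) = cong suc (toℕ-punchIn-< i j j<i)

toℕ-punchIn-≥ : ∀ {n} (i : Fin (suc n)) (j : Fin n) → toℕ i ℕ.≤ toℕ j → toℕ (punchIn i j) ≡ suc (toℕ j)
toℕ-punchIn-≥ zero    j       _         = refl
toℕ-punchIn-≥ (suc i) (suc j) (s≤s i≤j) = cong suc (toℕ-punchIn-≥ i j i≤j)

toℕ-punchOut-< : ∀ {n} {i j : Fin (suc n)} (i≢j : i ≢ j) → toℕ j ℕ.< toℕ i → toℕ (punchOut i≢j) ≡ toℕ j
toℕ-punchOut-< {suc n} {suc i} {zero}  i≢j _         = refl
toℕ-punchOut-< {suc n} {suc i} {suc j} i≢j (s≤s j<i) = cong suc (toℕ-punchOut-< (i≢j ∘ cong suc) j<i)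

toℕ-punchOut-> : ∀ {n} {i j : Fin (suc n)} (i≢j : i ≢ j) → toℕ i ℕ.< toℕ j → suc (toℕ (punchOut i≢j)) ≡ toℕ j
toℕ-punchOut-> {n}     {zero}  {suc j} i≢j _         = refl
toℕ-punchOut-> {suc n} {suc i} {suc j} i≢j (s≤s i<j) = cong suc (toℕ-punchOut-> (i≢j ∘ cong suc) i<j)

punchIn≡⇒punchOut : ∀ {n} {j c : Fin (suc n)} (j≢c : j ≢ c) (k : Fin n) → punchIn j k ≡ c → k ≡ punchOut j≢c
punchIn≡⇒punchOut {j = j} j≢c k refl = trans (sym (punchOut-punchIn j)) (punchOut-cong j refl)

det-minor-agree : ∀ n (c : Fin (suc n)) (A C : Matrix (suc n)) →
  (∀ i j → j ≢ c → A i j ≡ C i j) → det n (minor₀ A c) ≡ det n (minor₀ C c)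
det-minor-agree n c A C h = det-cong n (λ r k → h (suc r) (punchIn c k) (punchInᵢ≢i c k))

minor-agree : ∀ {n} (A C : Matrix (suc n)) {c j : Fin (suc n)} (j≢c : j ≢ c) →
  (∀ i k → k ≢ c → A i k ≡ C i k) →
  ∀ r k → k ≢ punchOut j≢c → minor₀ A j r k ≡ minor₀ C j r k
minor-agree A C j≢c h r k k≢ = h (suc r) _ (k≢ ∘ punchIn≡⇒punchOut j≢c k)

det-linear-col : ∀ n (c : Fin n) (A B C : Matrix n) →
  (∀ i j → j ≢ c → A i j ≡ C i j) → (∀ i j → j ≢ c → B i j ≡ C i j) →
  (∀ i → C i c ≡ A i c + B i c) → det n C ≡ det n A + det n B
det-linear-col (suc n) c A B C hA hB hC =
  trans (sumFin-cong term) (sumFin-+ (rowTerm A) (rowTerm B))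
  where
  term : ∀ j → rowTerm C j ≡ rowTerm A j + rowTerm B j
  term j with j ≟F c
  ... | yes refl = begin
    sgn (toℕ j) * C zero j * det n (minor₀ C j)
      ≡⟨ cong₂ (λ x y → sgn (toℕ j) * x * y) (hC zero) (sym (det-minor-agree n j A C hA)) ⟩
    sgn (toℕ j) * (A zero j + B zero j) * det n (minor₀ A j)
      ≡⟨ distrib (sgn (toℕ j)) (A zero j) (B zero j) (det n (minor₀ A j)) ⟩
    sgn (toℕ j) * A zero j * det n (minor₀ A j) + sgn (toℕ j) * B zero j * det n (minor₀ A j)
      ≡⟨ cong (λ y → rowTerm A j + sgn (toℕ j) * B zero j * y)
              (trans (det-minor-agree n j A C hA) (sym (det-minor-agree n j B C hB))) ⟩
    rowTerm A j + rowTerm B j ∎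
    where
    open ≡-Reasoning
    distrib : ∀ s a b d → s * (a + b) * d ≡ s * a * d + s * b * d
    distrib = solve-∀
  ... | no j≢c = begin
    sgn (toℕ j) * C zero j * det n (minor₀ C j)
      ≡⟨ cong (sgn (toℕ j) * C zero j *_)
              (det-linear-col n (punchOut j≢c) (minor₀ A j) (minor₀ B j) (minor₀ C j)
                 (minor-agree A C j≢c hA) (minor-agree B C j≢c hB)
                 (λ r → subst (λ z → C (suc r) z ≡ A (suc r) z + B (suc r) z) (sym (punchIn-punchOut j≢c)) (hC (suc r)))) ⟩
    sgn (toℕ j) * C zero j * (det n (minor₀ A j) + det n (minor₀ B j))
      ≡⟨ distrib (sgn (toℕ j) * C zero j) (det n (minor₀ A j)) (det n (minor₀ B j)) ⟩
    sgn (toℕ j) * C zero j * det n (minor₀ A j) + sgn (toℕ j) * C zero j * det n (minor₀ B j)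
      ≡⟨ cong₂ (λ x y → sgn (toℕ j) * x * det n (minor₀ A j) + sgn (toℕ j) * y * det n (minor₀ B j))
               (sym (hA zero j j≢c)) (sym (hB zero j j≢c)) ⟩
    rowTerm A j + rowTerm B j ∎
    where
    open ≡-Reasoning
    distrib : ∀ s a b → s * (a + b) ≡ s * a + s * b
    distrib = solve-∀

det-scale-col : ∀ n (c : Fin n) (t : ℤ) (A C : Matrix n) →
  (∀ i j → j ≢ c → A i j ≡ C i j) → (∀ i → C i c ≡ t * A i c) → det n C ≡ t * det n A
det-scale-col (suc n) c t A C hA hC =
  trans (sumFin-cong term) (sumFin-*ˡ t (rowTerm A))
  where
  term : ∀ j → rowTerm C j ≡ t * rowTerm A j
  term j with j ≟F c
  ... | yes refl =
    trans (cong₂ (λ x y → sgn (toℕ j) * x * y) (hC zero) (sym (det-minor-agree n j A C hA)))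
          (regroup (sgn (toℕ j)) t (A zero j) (det n (minor₀ A j)))
    where
    regroup : ∀ s t a d → s * (t * a) * d ≡ t * (s * a * d)
    regroup = solve-∀
  ... | no j≢c =
    trans (cong₂ (λ x y → sgn (toℕ j) * x * y) (sym (hA zero j j≢c))
            (det-scale-col n (punchOut j≢c) t (minor₀ A j) (minor₀ C j) (minor-agree A C j≢c hA)
               (λ r → subst (λ z → C (suc r) z ≡ t * A (suc r) z) (sym (punchIn-punchOut j≢c)) (hC (suc r)))))
          (regroup (sgn (toℕ j)) t (A zero j) (det n (minor₀ A j)))
    where
    regroup : ∀ s t a d → s * a * (t * d) ≡ t * (s * a * d)
    regroup = solve-∀

det-zero-col : ∀ n (A : Matrix n) (c : Fin n) → (∀ i → A i c ≡ + 0) → det n A ≡ + 0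
det-zero-col n A c h =
  trans (det-scale-col n c (+ 0) A A (λ _ _ _ → refl) (λ i → trans (h i) (sym (*-zeroˡ (A i c)))))
        (*-zeroˡ (det n A))

minor-adjacent-equal : ∀ {n} (A : Matrix (suc n)) (c d : Fin (suc n)) → toℕ d ≡ suc (toℕ c) →
  (∀ i → A i c ≡ A i d) → ∀ r k → A r (punchIn c k) ≡ A r (punchIn d k)
minor-adjacent-equal A c d d≡c+1 h r k with ℕP.<-cmp (toℕ k) (toℕ c)
... | tri< k<c _ _ = cong (A r) (toℕ-injective (trans (toℕ-punchIn-< c k k<c) (sym (toℕ-punchIn-< d k k<d))))
  where
  k<d : toℕ k ℕ.< toℕ d
  k<d = ℕP.<-trans k<c (subst (toℕ c ℕ.<_) (sym d≡c+1) (ℕP.n<1+n _))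
... | tri≈ _ k≡c _ = trans (cong (A r) (toℕ-injective (trans (toℕ-punchIn-≥ c k (ℕP.≤-reflexive (sym k≡c))) (trans (cong suc k≡c) (sym d≡c+1)))))
                       (trans (sym (h r)) (cong (A r) (toℕ-injective (trans (sym k≡c) (sym (toℕ-punchIn-< d k k<d))))))
  where
  k<d : toℕ k ℕ.< toℕ d
  k<d = subst (toℕ k ℕ.<_) (sym d≡c+1) (s≤s (ℕP.≤-reflexive k≡c))
... | tri> _ _ c<k = cong (A r) (toℕ-injective (trans (toℕ-punchIn-≥ c k (ℕP.<⇒≤ c<k))
                       (sym (toℕ-punchIn-≥ d k (subst (ℕ._≤ toℕ k) (sym d≡c+1) c<k)))))

punchOut-adjacent : ∀ {n} {c d j : Fin (suc n)} (j≢c : j ≢ c) (j≢d : j ≢ d) → toℕ d ≡ suc (toℕ c) →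
  toℕ (punchOut j≢d) ≡ suc (toℕ (punchOut j≢c))
punchOut-adjacent {c = c} {d} {j} j≢c j≢d d≡c+1 with ℕP.<-cmp (toℕ j) (toℕ c)
... | tri< j<c _ _ = ℕP.suc-injective (trans (toℕ-punchOut-> j≢d (ℕP.<-trans j<c c<d))
                        (trans d≡c+1 (cong suc (sym (toℕ-punchOut-> j≢c j<c)))))
  where
  c<d : toℕ c ℕ.< toℕ d
  c<d = subst (toℕ c ℕ.<_) (sym d≡c+1) (ℕP.n<1+n _)
... | tri≈ _ j≡c _ = ⊥-elim (j≢c (toℕ-injective j≡c))
... | tri> _ _ c<j with ℕP.<-cmp (toℕ j) (toℕ d)
...   | tri< j<d _ _ = ⊥-elim (ℕP.<-irrefl refl (ℕP.<-≤-trans j<d (subst (ℕ._≤ toℕ j) (sym d≡c+1) c<j)))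
...   | tri≈ _ j≡d _ = ⊥-elim (j≢d (toℕ-injective j≡d))
...   | tri> _ _ d<j = trans (toℕ-punchOut-< j≢d d<j) (trans d≡c+1 (cong suc (sym (toℕ-punchOut-< j≢c c<j))))

-- Two equal adjacent columns: the first-row terms at c and d cancel, all
-- others vanish by induction.
det-adjacent-equal-cols : ∀ n (A : Matrix n) (c d : Fin n) → toℕ d ≡ suc (toℕ c) →
  (∀ i → A i c ≡ A i d) → det n A ≡ + 0
det-adjacent-equal-cols (suc n) A c d d≡c+1 h =
  trans (sumFin-pair (rowTerm A) c d c≢d others) cancel
  where
  c≢d : c ≢ d
  c≢d refl = ℕP.<-irrefl d≡c+1 (ℕP.n<1+n _)
  others : ∀ j → j ≢ c → j ≢ d → rowTerm A j ≡ + 0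
  others j j≢c j≢d =
    trans (cong (sgn (toℕ j) * A zero j *_)
            (det-adjacent-equal-cols n (minor₀ A j) (punchOut j≢c) (punchOut j≢d) (punchOut-adjacent j≢c j≢d d≡c+1)
              (λ r → subst₂ (λ u v → A (suc r) u ≡ A (suc r) v)
                        (sym (punchIn-punchOut j≢c)) (sym (punchIn-punchOut j≢d)) (h (suc r)))))
          (*-zeroʳ (sgn (toℕ j) * A zero j))
  cancel : rowTerm A c + rowTerm A d ≡ + 0
  cancel = begin
    rowTerm A c + sgn (toℕ d) * A zero d * det n (minor₀ A d)
      ≡⟨ cong₂ (λ s y → rowTerm A c + sgn s * A zero d * y) d≡c+1
               (sym (det-cong n (λ r k → minor-adjacent-equal A c d d≡c+1 h (suc r) k))) ⟩
    rowTerm A c + sgn (suc (toℕ c)) * A zero d * det n (minor₀ A c)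
      ≡⟨ cong (λ x → rowTerm A c + sgn (suc (toℕ c)) * x * det n (minor₀ A c)) (sym (h zero)) ⟩
    rowTerm A c + - + 1 * sgn (toℕ c) * A zero c * det n (minor₀ A c)
      ≡⟨ opposite (sgn (toℕ c)) (A zero c) (det n (minor₀ A c)) ⟩
    + 0 ∎
    where
    open ≡-Reasoning
    opposite : ∀ s a m → s * a * m + - + 1 * s * a * m ≡ + 0
    opposite = solve-∀

setCol : ∀ {n} → Matrix n → Fin n → (Fin n → ℤ) → Matrix n
setCol A c u i j with j ≟F c
... | yes _ = u i
... | no  _ = A i j

setCol-at : ∀ {n} (A : Matrix n) c u i → setCol A c u i c ≡ u i
setCol-at A c u i with c ≟F c
... | yes _   = refl
... | no  c≢c = ⊥-elim (c≢c refl)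

setCol-off : ∀ {n} (A : Matrix n) c u i j → j ≢ c → setCol A c u i j ≡ A i j
setCol-off A c u i j j≢c with j ≟F c
... | yes j≡c = ⊥-elim (j≢c j≡c)
... | no  _   = refl

transpose-at-i : ∀ {n} (i j : Fin n) → transpose i j i ≡ j
transpose-at-i i j rewrite dec-true (i ≟F i) refl = refl

transpose-at-j : ∀ {n} (i j : Fin n) → j ≢ i → transpose i j j ≡ i
transpose-at-j i j j≢i rewrite dec-false (j ≟F i) j≢i | dec-true (j ≟F j) refl = refl

transpose-other : ∀ {n} (i j k : Fin n) → k ≢ i → k ≢ j → transpose i j k ≡ k
transpose-other i j k k≢i k≢j rewrite dec-false (k ≟F i) k≢i | dec-false (k ≟F j) k≢j = refl

swapCols : ∀ {n} → Matrix n → Fin n → Fin n → Matrix n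
swapCols A c d i j = A i (transpose c d j)

-- Writing
-- E x y for A with columns c, d replaced by x, y, bilinearity gives
-- 0 = E(u+v)(u+v) = E u v + E v u, with u, v the columns c, d of A.
det-swap-cols-from : ∀ n (c d : Fin n) → c ≢ d →
  ((B : Matrix n) → (∀ i → B i c ≡ B i d) → det n B ≡ + 0) →
  (A : Matrix n) → det n (swapCols A c d) ≡ - det n A
det-swap-cols-from n c d c≢d vanish A = begin
  det n (swapCols A c d)   ≡⟨ sym (det-cong n swapped) ⟩
  det n (E v u)            ≡⟨ cancel (det n (E v u)) (det n (E u v)) (det n (E u u)) (det n (E v v)) (det n (E w w)) expand
                                (diagonal u) (diagonal v) (diagonal w) ⟩
  - det n (E u v)          ≡⟨ cong -_ (det-cong n original) ⟩
  - det n A                ∎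
  where
  open ≡-Reasoning
  d≢c : d ≢ c
  d≢c = c≢d ∘ sym
  u v w : Fin n → ℤ
  u i = A i c
  v i = A i d
  w i = u i + v i
  E : (Fin n → ℤ) → (Fin n → ℤ) → Matrix n
  E x y = setCol (setCol A d y) c x
  E-c : ∀ x y i → E x y i c ≡ x i
  E-c x y = setCol-at (setCol A d y) c x
  E-d : ∀ x y i → E x y i d ≡ y i
  E-d x y i = trans (setCol-off (setCol A d y) c x i d d≢c) (setCol-at A d y i)
  E-off-c : ∀ x x' y i j → j ≢ c → E x y i j ≡ E x' y i j
  E-off-c x x' y i j j≢c = trans (setCol-off _ c x i j j≢c) (sym (setCol-off _ c x' i j j≢c))
  E-off-d : ∀ x y y' i j → j ≢ d → E x y i j ≡ E x y' i j
  E-off-d x y y' i j j≢d with j ≟F c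
  ... | yes _   = refl
  ... | no  _   = trans (setCol-off A d y i j j≢d) (sym (setCol-off A d y' i j j≢d))
  linear-c : ∀ x x' y → det n (E (λ i → x i + x' i) y) ≡ det n (E x y) + det n (E x' y)
  linear-c x x' y = det-linear-col n c (E x y) (E x' y) (E (λ i → x i + x' i) y)
    (E-off-c x _ y) (E-off-c x' _ y)
    (λ i → trans (E-c _ y i) (sym (cong₂ _+_ (E-c x y i) (E-c x' y i))))
  linear-d : ∀ x y y' → det n (E x (λ i → y i + y' i)) ≡ det n (E x y) + det n (E x y')
  linear-d x y y' = det-linear-col n d (E x y) (E x y') (E x (λ i → y i + y' i))
    (E-off-d x y _) (E-off-d x y' _)
    (λ i → trans (E-d x _ i) (sym (cong₂ _+_ (E-d x y i) (E-d x y' i))))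
  diagonal : ∀ x → det n (E x x) ≡ + 0
  diagonal x = vanish (E x x) (λ i → trans (E-c x x i) (sym (E-d x x i)))
  expand : det n (E w w) ≡ det n (E u u) + det n (E u v) + (det n (E v u) + det n (E v v))
  expand = trans (linear-c u v w) (cong₂ _+_ (linear-d u u v) (linear-d v u v))
  cancel : ∀ vu uv uu vv ww → ww ≡ uu + uv + (vu + vv) → uu ≡ + 0 → vv ≡ + 0 → ww ≡ + 0 → vu ≡ - uv
  cancel vu uv _ _ _ refl refl refl sum≡0 =
    trans (rearrange vu uv) (trans (cong (_- uv) sum≡0) (+-identityˡ (- uv)))
    where
    rearrange : ∀ vu uv → vu ≡ + 0 + uv + (vu + + 0) - uv
    rearrange = solve-∀
  columnwise : ∀ {x y : Fin n → ℤ} (B : Matrix n) → (∀ i → B i c ≡ x i) → (∀ i → B i d ≡ y i) →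
    (∀ i j → j ≢ c → j ≢ d → B i j ≡ A i j) → ∀ i j → E x y i j ≡ B i j
  columnwise {x} {y} B hc hd ho i j = cases (j ≟F c) (j ≟F d)
    where
    cases : Dec (j ≡ c) → Dec (j ≡ d) → E x y i j ≡ B i j
    cases (yes refl) _          = trans (E-c x y i) (sym (hc i))
    cases (no _)     (yes refl) = trans (E-d x y i) (sym (hd i))
    cases (no j≢c)   (no j≢d)   =
      trans (trans (setCol-off _ c x i j j≢c) (setCol-off A d y i j j≢d)) (sym (ho i j j≢c j≢d))
  original : ∀ i j → E u v i j ≡ A i j
  original = columnwise A (λ _ → refl) (λ _ → refl) (λ _ _ _ _ → refl)
  swapped : ∀ i j → E v u i j ≡ swapCols A c d i j
  swapped = columnwise (swapCols A c d)
    (λ i → cong (A i) (transpose-at-i c d))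
    (λ i → cong (A i) (transpose-at-j c d d≢c))
    (λ i j j≢c j≢d → cong (A i) (transpose-other c d j j≢c j≢d))

-- Equal columns at distance m+1: move column d next to c by adjacent swaps.
det-equal-cols-at-distance : ∀ m n (A : Matrix n) (c d : Fin n) → toℕ d ≡ toℕ c ℕ.+ suc m →
  (∀ i → A i c ≡ A i d) → det n A ≡ + 0
det-equal-cols-at-distance zero    n A c d d≡c+1 h =
  det-adjacent-equal-cols n A c d (trans d≡c+1 (ℕP.+-comm (toℕ c) 1)) h
det-equal-cols-at-distance (suc m) (suc n) A c zero eq h = ⊥-elim (ℕP.0≢1+n (trans eq (ℕP.+-suc (toℕ c) (suc m))))
det-equal-cols-at-distance (suc m) (suc n) A c (suc d) eq h = begin
  det (suc n) A              ≡⟨ sym (neg-involutive (det (suc n) A)) ⟩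
  - - det (suc n) A          ≡⟨ cong -_ (sym swapped) ⟩
  - det (suc n) B            ≡⟨ cong -_ (det-equal-cols-at-distance m (suc n) B c e e≡c+m+1 B-equal) ⟩
  - + 0                      ∎
  where
  open ≡-Reasoning
  e : Fin (suc n)
  e = inject₁ d
  d+1≡e+1 : toℕ (suc d) ≡ suc (toℕ e)
  d+1≡e+1 = cong suc (sym (toℕ-inject₁ d))
  e<d+1 : toℕ e ℕ.< toℕ (suc d)
  e<d+1 = subst (toℕ e ℕ.<_) (sym d+1≡e+1) (ℕP.n<1+n _)
  e≢d+1 : e ≢ suc d
  e≢d+1 e≡ = ℕP.<-irrefl (cong toℕ e≡) e<d+1
  B : Matrix (suc n)
  B = swapCols A e (suc d)
  swapped : det (suc n) B ≡ - det (suc n) A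
  swapped = det-swap-cols-from (suc n) e (suc d) e≢d+1
              (λ B' h' → det-adjacent-equal-cols (suc n) B' e (suc d) d+1≡e+1 h') A
  e≡c+m+1 : toℕ e ≡ toℕ c ℕ.+ suc m
  e≡c+m+1 = ℕP.suc-injective (trans (sym d+1≡e+1) (trans eq (ℕP.+-suc (toℕ c) (suc m))))
  c<e : toℕ c ℕ.< toℕ e
  c<e = subst (toℕ c ℕ.<_) (sym e≡c+m+1) (ℕP.m<m+n (toℕ c) (s≤s z≤n))
  B-equal : ∀ i → B i c ≡ B i e
  B-equal i = trans (cong (A i) (transpose-other e (suc d) c (λ c≡e → ℕP.<-irrefl (cong toℕ c≡e) c<e)
                                   (λ c≡d+1 → ℕP.<-irrefl (cong toℕ c≡d+1) (ℕP.<-trans c<e e<d+1))))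
                    (trans (h i) (sym (cong (A i) (transpose-at-i e (suc d)))))

det-equal-cols : ∀ n (A : Matrix n) (c d : Fin n) → c ≢ d → (∀ i → A i c ≡ A i d) → det n A ≡ + 0
det-equal-cols n A c d c≢d h with ℕP.<-cmp (toℕ c) (toℕ d)
... | tri< c<d _ _ = det-equal-cols-at-distance (toℕ d ∸ suc (toℕ c)) n A c d
                       (sym (trans (ℕP.+-suc (toℕ c) _) (ℕP.m+[n∸m]≡n c<d))) h
... | tri≈ _ c≡d _ = ⊥-elim (c≢d (toℕ-injective c≡d))
... | tri> _ _ d<c = det-equal-cols-at-distance (toℕ c ∸ suc (toℕ d)) n A d c
                       (sym (trans (ℕP.+-suc (toℕ d) _) (ℕP.m+[n∸m]≡n d<c))) (sym ∘ h)

det-swap-cols : ∀ n (A : Matrix n) (c d : Fin n) → c ≢ d → det n (swapCols A c d) ≡ - det n A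
det-swap-cols n A c d c≢d = det-swap-cols-from n c d c≢d (λ B → det-equal-cols n B c d c≢d) A

det-add-col-multiple : ∀ n (B B' : Matrix n) (c e : Fin n) → c ≢ e → (l : ℤ) →
  (∀ i j → j ≢ c → B' i j ≡ B i j) → (∀ i → B' i c ≡ B i c + l * B i e) → det n B' ≡ det n B
det-add-col-multiple n B B' c e c≢e l off at = begin
  det n B'                  ≡⟨ det-linear-col n c B (setCol B c le) B' (λ i j j≢c → sym (off i j j≢c))
                                 (λ i j j≢c → trans (setCol-off B c le i j j≢c) (sym (off i j j≢c)))
                                 (λ i → trans (at i) (cong (_+_ (B i c)) (sym (setCol-at B c le i)))) ⟩
  det n B + det n (setCol B c le)
                            ≡⟨ cong (_+_ (det n B)) (det-scale-col n c l (setCol B c e') (setCol B c le)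
                                 (λ i j j≢c → trans (setCol-off B c e' i j j≢c) (sym (setCol-off B c le i j j≢c)))
                                 (λ i → trans (setCol-at B c le i) (cong (l *_) (sym (setCol-at B c e' i))))) ⟩
  det n B + l * det n (setCol B c e')
                            ≡⟨ cong (λ z → det n B + l * z) (det-equal-cols n (setCol B c e') c e c≢e
                                 (λ i → trans (setCol-at B c e' i) (sym (setCol-off B c e' i e (c≢e ∘ sym))))) ⟩
  det n B + l * + 0         ≡⟨ cong (_+_ (det n B)) (*-zeroʳ l) ⟩
  det n B + + 0             ≡⟨ +-identityʳ (det n B) ⟩
  det n B                   ∎
  where
  open ≡-Reasoning
  e' le : Fin n → ℤ
  e' i = B i e
  le i = l * B i e

δ : ∀ {a} {P : Set a} → Dec P → ℤ
δ (yes _) = + 1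
δ (no _)  = + 0

identity : ∀ {n} → Matrix n
identity i j = δ (i ≟F j)

identity-diag : ∀ {n} (i : Fin n) → identity i i ≡ + 1
identity-diag i with i ≟F i
... | yes _   = refl
... | no  i≢i = ⊥-elim (i≢i refl)

identity-off : ∀ {n} (i j : Fin n) → i ≢ j → identity i j ≡ + 0
identity-off i j i≢j with i ≟F j
... | yes i≡j = ⊥-elim (i≢j i≡j)
... | no  _   = refl

identity-suc : ∀ {n} (i j : Fin n) → identity (suc i) (suc j) ≡ identity i j
identity-suc i j = cases (i ≟F j)
  where
  cases : Dec (i ≡ j) → identity (suc i) (suc j) ≡ identity i j
  cases (yes refl) = trans (identity-diag (suc i)) (sym (identity-diag i))
  cases (no i≢j)   = trans (identity-off (suc i) (suc j) (i≢j ∘ suc-injective)) (sym (identity-off i j i≢j))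

det-identity : ∀ n → det n identity ≡ + 1
det-identity zero    = refl
det-identity (suc n) =
  cong₂ _+_ (cong₂ (λ a d → sgn 0 * a * d) (identity-diag {suc n} zero)
                   (trans (det-cong n identity-suc) (det-identity n)))
            (sumFin-zero (λ j → rowTerm identity (suc j))
               (λ j → trans (cong (λ a → sgn (suc (toℕ j)) * a * det n (minor₀ identity (suc j)))
                               (identity-off zero (suc j) (λ ())))
                             (annihilate (sgn (suc (toℕ j))) (det n (minor₀ identity (suc j))))))
  where
  annihilate : ∀ s d → s * + 0 * d ≡ + 0
  annihilate = solve-∀

-- σ acts on columns by a scalar factor: the sign of σ if it is a
-- permutation, and 0 otherwise.
ColumnFactor : ∀ n → (Fin n → Fin n) → Set
ColumnFactor n σ = Σ ℤ λ s → ∀ (A : Matrix n) → det n (λ i j → A i (σ j)) ≡ s * det n A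

-- A map missing some value c has factor 0: it sends n+1 columns into n
-- values, so two columns of A ∘ σ coincide.
columnFactor-missing : ∀ n (σ : Fin (suc n) → Fin (suc n)) (c : Fin (suc n)) →
  (∀ j → c ≢ σ j) → ColumnFactor (suc n) σ
columnFactor-missing n σ c avoid = + 0 , λ A →
  trans (det-equal-cols (suc n) (λ i j → A i (σ j)) i₀ j₀ (λ i₀≡j₀ → ℕP.<-irrefl (cong toℕ i₀≡j₀) i₀<j₀)
           (λ r → cong (A r) (punchOut-injective (avoid i₀) (avoid j₀) collide)))
        (sym (*-zeroˡ (det (suc n) A)))
  where
  collision = pigeonhole ℕP.≤-refl (λ j → punchOut (avoid j))
  i₀ = proj₁ collision
  j₀ = proj₁ (proj₂ collision)
  i₀<j₀ = proj₁ (proj₂ (proj₂ collision))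
  collide = proj₂ (proj₂ (proj₂ collision))

columnFactor-transpose : ∀ n (σ : Fin n → Fin n) (e c : Fin n) → e ≢ c →
  ColumnFactor n (σ ∘ transpose e c) → ColumnFactor n σ
columnFactor-transpose n σ e c e≢c (s , factor) = - s , λ A → begin
  det n (λ i j → A i (σ j))                    ≡⟨ det-cong n (λ i j → cong (A i ∘ σ) (sym (transpose-inverse e c {j}))) ⟩
  det n (swapCols (λ i j → A i (σ′ j)) c e)    ≡⟨ det-swap-cols n (λ i j → A i (σ′ j)) c e (e≢c ∘ sym) ⟩
  - det n (λ i j → A i (σ′ j))                 ≡⟨ cong -_ (factor A) ⟩
  - (s * det n A)                              ≡⟨ neg-distribˡ s (det n A) ⟩
  - s * det n A                                ∎
  where
  open ≡-Reasoning
  σ′ : Fin n → Fin n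
  σ′ = σ ∘ transpose e c
  neg-distribˡ : ∀ a b → - (a * b) ≡ - a * b
  neg-distribˡ = solve-∀

-- Induction on the number d of positions not yet known to be fixed by σ.
-- At the first such position c: if σ c = c, continue; if σ e = c for some
-- e ≠ c, σ ∘ (e c) fixes c as well; otherwise c is missed by σ.
columnFactor-from : ∀ d n k → k ℕ.+ d ≡ n → (σ : Fin n → Fin n) →
  (∀ i → toℕ i ℕ.< k → σ i ≡ i) → ColumnFactor n σ
columnFactor-from zero n k k≡n σ fixed = + 1 , λ A →
  trans (det-cong n (λ i j → cong (A i) (fixed j (subst (toℕ j ℕ.<_) (sym k+0≡n) (toℕ<n j)))))
        (sym (*-identityˡ (det n A)))
  where
  k+0≡n : k ≡ n
  k+0≡n = trans (sym (ℕP.+-identityʳ k)) k≡n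
columnFactor-from (suc d) zero k k+d≡n σ fixed = ⊥-elim (ℕP.1+n≢0 (trans (sym (ℕP.+-suc k d)) k+d≡n))
columnFactor-from (suc d) (suc n) k k+d≡n σ fixed = atFirstFree (σ c ≟F c)
  where
  c : Fin (suc n)
  c = fromℕ< (subst (k ℕ.<_) k+d≡n (ℕP.m<m+n k (s≤s z≤n)))
  tc : toℕ c ≡ k
  tc = toℕ-fromℕ< _
  IH : ∀ σ′ → (∀ i → toℕ i ℕ.< k → σ′ i ≡ i) → σ′ c ≡ c → ColumnFactor (suc n) σ′
  IH σ′ below at = columnFactor-from d (suc n) (suc k) (trans (sym (ℕP.+-suc k d)) k+d≡n) σ′ extended
    where
    extended : ∀ i → toℕ i ℕ.< suc k → σ′ i ≡ i
    extended i (s≤s i≤k) with ℕP.m≤n⇒m<n∨m≡n i≤k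
    ... | inj₁ i<k = below i i<k
    ... | inj₂ i≡k with toℕ-injective (trans i≡k (sym tc))
    ...   | refl = at
  atFirstFree : Dec (σ c ≡ c) → ColumnFactor (suc n) σ
  atFirstFree (yes σc≡c) = IH σ fixed σc≡c
  atFirstFree (no σc≢c)  = preimage (any? (λ j → σ j ≟F c))
    where
    preimage : Dec (∃ λ j → σ j ≡ c) → ColumnFactor (suc n) σ
    preimage (yes (e , σe≡c)) = columnFactor-transpose (suc n) σ e c e≢c
      (IH (σ ∘ transpose e c) below (trans (cong σ (transpose-at-j e c (e≢c ∘ sym))) σe≡c))
      where
      e≢c : e ≢ c
      e≢c refl = σc≢c σe≡c
      below : ∀ i → toℕ i ℕ.< k → σ (transpose e c i) ≡ i
      below i i<k = trans (cong σ (transpose-other e c i i≢e i≢c)) (fixed i i<k)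
        where
        i≢c : i ≢ c
        i≢c i≡c = ℕP.<-irrefl (trans (cong toℕ i≡c) tc) i<k
        i≢e : i ≢ e
        i≢e refl = e≢c (trans (sym (fixed i i<k)) σe≡c)
    preimage (no c∉σ) = columnFactor-missing n σ c (λ j c≡σj → c∉σ (j , sym c≡σj))

columnFactor : ∀ n (σ : Fin n → Fin n) → ColumnFactor n σ
columnFactor n σ = columnFactor-from n n 0 refl σ (λ i ())

det-reindex-rows : ∀ n (A : Matrix n) (σ : Fin n → Fin n) →
  det n (λ i j → A (σ i) j) ≡ det n (λ i j → identity (σ i) j) * det n A
det-reindex-rows n A σ = trans (rowFactor A) (cong (_* det n A) (sym (trans (rowFactor identity) identityFactor)))
  where
  s : ℤ
  s = proj₁ (columnFactor n σ)
  rowFactor : ∀ B → det n (λ i j → B (σ i) j) ≡ s * det n B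
  rowFactor B = trans (sym (det-transpose n (λ i j → B (σ i) j)))
                  (trans (proj₂ (columnFactor n σ) (transposeM B)) (cong (s *_) (det-transpose n B)))
  identityFactor : s * det n identity ≡ s
  identityFactor = trans (cong (s *_) (det-identity n)) (*-identityʳ s)

cyclicDiff : ℕ → ℕ → ℕ → ℕ
cyclicDiff n i j with i ℕ.≤? j
... | yes _ = j ∸ i
... | no  _ = n ℕ.+ j ∸ i

cyclicDiff-≤ : ∀ n i j → i ≤ j → cyclicDiff n i j ≡ j ∸ i
cyclicDiff-≤ n i j i≤j with i ℕ.≤? j
... | yes _   = refl
... | no  i≰j = ⊥-elim (i≰j i≤j)

cyclicDiff-> : ∀ n i j → ¬ (i ≤ j) → cyclicDiff n i j ≡ n ℕ.+ j ∸ i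
cyclicDiff-> n i j i≰j with i ℕ.≤? j
... | yes i≤j = ⊥-elim (i≰j i≤j)
... | no  _   = refl

cyclicDiff-self : ∀ n i → cyclicDiff n i i ≡ 0
cyclicDiff-self n i = trans (cyclicDiff-≤ n i i ℕP.≤-refl) (ℕP.n∸n≡0 i)

cyclicDiff-suc : ∀ n i j → i ℕ.< n → suc j ≢ i → cyclicDiff n i (suc j) ≡ suc (cyclicDiff n i j)
cyclicDiff-suc n i j i<n j+1≢i with i ℕ.≤? j
... | yes i≤j = trans (cyclicDiff-≤ n i (suc j) (ℕP.m≤n⇒m≤1+n i≤j)) (ℕP.+-∸-assoc 1 i≤j)
... | no  i≰j with i ℕ.≤? suc j
...   | yes i≤j+1 = ⊥-elim (j+1≢i (ℕP.≤-antisym (ℕP.≰⇒> i≰j) i≤j+1))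
...   | no  _     = trans (cong (_∸ i) (ℕP.+-suc n j)) (ℕP.+-∸-assoc 1 (ℕP.≤-trans (ℕP.<⇒≤ i<n) (ℕP.m≤m+n n j)))

cyclicDiff-behind : ∀ n k j → 0 ℕ.< k → cyclicDiff n (k ℕ.+ j) j ≡ n ∸ k
cyclicDiff-behind n k j 0<k =
  trans (cyclicDiff-> n (k ℕ.+ j) j (λ k+j≤j → ℕP.<-irrefl refl (ℕP.<-≤-trans (ℕP.m<n+m j 0<k) k+j≤j)))
        (trans (cong₂ _∸_ (ℕP.+-comm n j) (ℕP.+-comm k j)) (ℕP.[m+n]∸[m+o]≡n∸o j n k))

cyclicDiff-< : ∀ n i j → i ℕ.< n → j ℕ.< n → cyclicDiff n i j ℕ.< n
cyclicDiff-< n i j i<n j<n with i ℕ.≤? j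
... | yes _   = ℕP.≤-<-trans (ℕP.m∸n≤m j i) j<n
... | no  i≰j = ℕP.+-cancelʳ-< i _ n
                  (subst (ℕ._< n ℕ.+ i) (sym (ℕP.m∸n+n≡m (ℕP.≤-trans (ℕP.<⇒≤ i<n) (ℕP.m≤m+n n j))))
                     (ℕP.+-monoʳ-< n (ℕP.≰⇒> i≰j)))

cyclicDiff≡0⇒≡ : ∀ n i j → i ℕ.< n → cyclicDiff n i j ≡ 0 → i ≡ j
cyclicDiff≡0⇒≡ n i j i<n eq with i ℕ.≤? j
... | yes i≤j = ℕP.≤-antisym i≤j (ℕP.m∸n≡0⇒m≤n eq)
... | no  _   = ⊥-elim (ℕP.<-irrefl refl (ℕP.<-≤-trans i<n (ℕP.≤-trans (ℕP.m≤m+n n j) (ℕP.m∸n≡0⇒m≤n eq))))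

circulant : ∀ n → (ℕ → ℤ) → Matrix n
circulant n x i j = x (suc (cyclicDiff n (toℕ i) (toℕ j)))

residue-unique : ∀ N r r′ (d : ℤ) → r ℕ.< N → r′ ℕ.< N → + r - + r′ ≡ d * + N → r ≡ r′
residue-unique N r r′ (+ zero)   r<N r′<N eq = +-injective (trans (back (+ r) (+ r′)) (trans (cong (_+_ (+ r′)) eq) (+-identityʳ (+ r′))))
  where
  back : ∀ a b → a ≡ b + (a - b)
  back = solve-∀
residue-unique N r r′ (+ suc k)  r<N r′<N eq = ⊥-elim (ℕP.<-irrefl refl (ℕP.<-≤-trans r<N N≤r))
  where
  N≤r : N ≤ r
  N≤r = subst (N ≤_) (sym (gap-multiple r r′ k N eq)) (ℕP.≤-trans (ℕP.m≤n*m N (suc k)) (ℕP.m≤n+m (suc k ℕ.* N) r′))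
    where
    gap-multiple : ∀ r r′ k N → + r - + r′ ≡ + suc k * + N → r ≡ r′ ℕ.+ suc k ℕ.* N
    gap-multiple r r′ k N e = +-injective (trans (back (+ r) (+ r′))
      (trans (cong (_+_ (+ r′)) (trans e (sym (pos-* (suc k) N)))) (sym (pos-+ r′ (suc k ℕ.* N)))))
      where
      back : ∀ a b → a ≡ b + (a - b)
      back = solve-∀
residue-unique N r r′ -[1+ k ] r<N r′<N eq =
  sym (residue-unique N r′ r (+ suc k) r′<N r<N (trans (flip (+ r) (+ r′)) (trans (cong -_ eq) (unneg (+ suc k) (+ N)))))
  where
  flip : ∀ a b → b - a ≡ - (a - b)
  flip = solve-∀
  unneg : ∀ a N → - (- a * N) ≡ a * N
  unneg = solve-∀

%ℕ-unique : ∀ N (z : ℤ) r (t : ℤ) .{{_ : ℕ.NonZero N}} → r ℕ.< N → z ≡ + r + t * + N → z %ℕ N ≡ r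
%ℕ-unique N z r t r<N z≡ = sym (residue-unique N r (z %ℕ N) (z /ℕ N - t) r<N (n%ℕd<d z N)
  (trans (difference (+ r) (+ (z %ℕ N)) t (z /ℕ N) (+ N))
         (trans (cong₂ (λ α β → α - t * + N - β + (z /ℕ N) * + N) (sym z≡) (sym (a≡a%ℕn+[a/ℕn]*n z N)))
                (collapse z t (z /ℕ N) (+ N)))))
  where
  difference : ∀ a b t q N → a - b ≡ a + t * N - t * N - (b + q * N) + q * N
  difference = solve-∀
  collapse : ∀ z t q N → z - t * N - z + q * N ≡ (q - t) * N
  collapse = solve-∀

module Reindexing (n′ g : ℕ) where
  n : ℕ
  n = suc n′

  -- Row i of C_{n,g} is row (i g mod n) of the ordinary circulant.
  shift : ℕ → ℕ
  shift i = (i ℕ.* g) ND.% n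

  shift<n : ∀ i → shift i ℕ.< n
  shift<n i = ND.m%n<n (i ℕ.* g) n

  index-mod : ∀ i j → j ℕ.< n → (+ j - + i * + g) %ℕ n ≡ cyclicDiff n (shift i) j
  index-mod i j j<n = %ℕ-unique n (+ j - + i * + g) (cyclicDiff n s j) (proj₁ representation)
                        (cyclicDiff-< n s j (shift<n i) j<n) (proj₂ representation)
    where
    s = shift i
    Q = (i ℕ.* g) ND./ n
    ig≡ : + i * + g ≡ + s + + Q * + n
    ig≡ = trans (sym (pos-* i g)) (trans (cong +_ (ND.m≡m%n+[m/n]*n (i ℕ.* g) n))
            (trans (pos-+ s (Q ℕ.* n)) (cong (_+_ (+ s)) (pos-* Q n))))
    quotient : Dec (s ≤ j) → Σ ℤ (λ t → + j - + i * + g ≡ + (cyclicDiff n s j) + t * + n)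
    quotient (yes s≤j) = - + Q , (begin
      + j - + i * + g                 ≡⟨ cong₂ _-_ j≡ ig≡ ⟩
      + (j ∸ s) + + s - (+ s + + Q * + n) ≡⟨ regroup (+ (j ∸ s)) (+ s) (+ Q) (+ n) ⟩
      + (j ∸ s) + - + Q * + n          ≡⟨ cong (λ z → + z + - + Q * + n) (sym (cyclicDiff-≤ n s j s≤j)) ⟩
      + cyclicDiff n s j + - + Q * + n ∎)
      where
      open ≡-Reasoning
      j≡ : + j ≡ + (j ∸ s) + + s
      j≡ = trans (cong +_ (sym (ℕP.m∸n+n≡m s≤j))) (pos-+ (j ∸ s) s)
      regroup : ∀ d s Q n → d + s - (s + Q * n) ≡ d + - Q * n
      regroup = solve-∀
    quotient (no s≰j) = - (+ 1 + + Q) , (begin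
      + j - + i * + g                        ≡⟨ cong₂ _-_ j≡ ig≡ ⟩
      + (n ℕ.+ j ∸ s) + + s - + n - (+ s + + Q * + n)
                                             ≡⟨ regroup (+ (n ℕ.+ j ∸ s)) (+ s) (+ Q) (+ n) ⟩
      + (n ℕ.+ j ∸ s) + - (+ 1 + + Q) * + n  ≡⟨ cong (λ z → + z + - (+ 1 + + Q) * + n) (sym (cyclicDiff-> n s j s≰j)) ⟩
      + cyclicDiff n s j + - (+ 1 + + Q) * + n ∎)
      where
      open ≡-Reasoning
      j≡ : + j ≡ + (n ℕ.+ j ∸ s) + + s - + n
      j≡ = trans (add-sub (+ j) (+ n)) (cong (_- + n) (sym (trans (sym (pos-+ (n ℕ.+ j ∸ s) s))
             (trans (cong +_ (ℕP.m∸n+n≡m (ℕP.≤-trans (ℕP.<⇒≤ (shift<n i)) (ℕP.m≤m+n n j)))) (pos-+ n j)))))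
        where
        add-sub : ∀ j n → j ≡ n + j - n
        add-sub = solve-∀
      regroup : ∀ d s Q n → d + s - n - (s + Q * n) ≡ d + - (+ 1 + Q) * n
      regroup = solve-∀
    representation : Σ ℤ (λ t → + j - + i * + g ≡ + (cyclicDiff n s j) + t * + n)
    representation = quotient (s ℕ.≤? j)

  σ : Fin n → Fin n
  σ i = fromℕ< (shift<n (toℕ i))

  index-mod-σ : ∀ i j → modN (+ toℕ j - + toℕ i * + g) n ≡ cyclicDiff n (toℕ (σ i)) (toℕ j)
  index-mod-σ i j = trans (index-mod (toℕ i) (toℕ j) (toℕ<n j))
                          (cong (λ z → cyclicDiff n z (toℕ j)) (sym (toℕ-fromℕ< (shift<n (toℕ i)))))

  Cg≡circulant : ∀ x i j → Cg n g x i j ≡ circulant n x (σ i) j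
  Cg≡circulant x i j = cong (λ z → x (suc z)) (index-mod-σ i j)

  Qg≡identity : ∀ i j → Qg n g i j ≡ identity (σ i) j
  Qg≡identity i j with modN (+ toℕ j - + toℕ i * + g) n ℕ.≟ 0
  ... | yes ≡0 = sym (trans (cong (λ z → identity z j) σi≡j) (identity-diag j))
    where
    σi≡j : σ i ≡ j
    σi≡j = toℕ-injective (cyclicDiff≡0⇒≡ n (toℕ (σ i)) (toℕ j) (toℕ<n (σ i)) (trans (sym (index-mod-σ i j)) ≡0))
  ... | no ≢0 = sym (identity-off (σ i) j (λ σi≡j → ≢0 (trans (index-mod-σ i j)
                  (trans (cong (λ z → cyclicDiff n (toℕ z) (toℕ j)) σi≡j) (cyclicDiff-self n (toℕ j))))))

-- det C_{n,g}(x) = det Q_g · det C_{n,1}(x).  (No coprimality is needed: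
-- when gcd(n, g) ≠ 1 both sides vanish.)
det-Cg : ∀ n g (x : ℕ → ℤ) → det (suc n) (Cg (suc n) g x) ≡ det (suc n) (Qg (suc n) g) * det (suc n) (circulant (suc n) x)
det-Cg n g x = begin
  det (suc n) (Cg (suc n) g x)                                   ≡⟨ det-cong (suc n) (Cg≡circulant x) ⟩
  det (suc n) (λ i j → circulant (suc n) x (σ i) j)              ≡⟨ det-reindex-rows (suc n) (circulant (suc n) x) σ ⟩
  det (suc n) (λ i j → identity (σ i) j) * det (suc n) (circulant (suc n) x)
                                                                 ≡⟨ cong (_* det (suc n) (circulant (suc n) x)) (sym (det-cong (suc n) Qg≡identity)) ⟩
  det (suc n) (Qg (suc n) g) * det (suc n) (circulant (suc n) x) ∎
  where
  open ≡-Reasoning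
  open Reindexing n g using (σ; Cg≡circulant; Qg≡identity)

det-first-row-two : ∀ m (A : Matrix (suc (suc m))) → (∀ j → A zero (suc (suc j)) ≡ + 0) →
  det (suc (suc m)) A ≡ A zero zero * det (suc m) (minor₀ A zero) - A zero (suc zero) * det (suc m) (minor₀ A (suc zero))
det-first-row-two m A row₀ =
  trans (cong (λ z → rowTerm A zero + (rowTerm A (suc zero) + z)) (sumFin-zero _ (λ j → vanishing j)))
        (simplify (A zero zero) (A zero (suc zero)) (det (suc m) (minor₀ A zero)) (det (suc m) (minor₀ A (suc zero))))
  where
  vanishing : ∀ j → rowTerm A (suc (suc j)) ≡ + 0
  vanishing j = trans (cong (λ a → sgn (toℕ (suc (suc j))) * a * det (suc m) (minor₀ A (suc (suc j)))) (row₀ j))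
                      (annihilate (sgn (toℕ (suc (suc j)))) (det (suc m) (minor₀ A (suc (suc j)))))
    where
    annihilate : ∀ s d → s * + 0 * d ≡ + 0
    annihilate = solve-∀
  simplify : ∀ a₀ a₁ d₀ d₁ → + 1 * a₀ * d₀ + (- + 1 * + 1 * a₁ * d₁ + + 0) ≡ a₀ * d₀ - a₁ * d₁
  simplify = solve-∀

det-size-one : (A : Matrix 1) → det 1 A ≡ A zero zero
det-size-one A = simplify (A zero zero)
  where
  simplify : ∀ a → + 1 * a * + 1 + + 0 ≡ a
  simplify = solve-∀

-- Band shapes with parameters a, b, described on ℕ-indices:
--   upperBand: a on the diagonal, b just above it;
--   lowerBand: b on the diagonal, a just below it;
--   bordered w: first column w, then lowerBand.
module Band (a b : ℤ) where

  upperBand : ℕ → ℕ → ℤ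
  upperBand zero    zero          = a
  upperBand (suc _) zero          = + 0
  upperBand zero    (suc zero)    = b
  upperBand zero    (suc (suc _)) = + 0
  upperBand (suc i) (suc j)       = upperBand i j

  lowerBand₀ : ℕ → ℤ
  lowerBand₀ zero          = b
  lowerBand₀ (suc zero)    = a
  lowerBand₀ (suc (suc _)) = + 0

  lowerBand : ℕ → ℕ → ℤ
  lowerBand i       zero    = lowerBand₀ i
  lowerBand zero    (suc _) = + 0
  lowerBand (suc i) (suc j) = lowerBand i j

  lowerBand-suc : ∀ i j → lowerBand (suc i) j ≡ upperBand i j
  lowerBand-suc zero    zero          = refl
  lowerBand-suc zero    (suc zero)    = refl
  lowerBand-suc zero    (suc (suc j)) = refl
  lowerBand-suc (suc i) zero          = refl
  lowerBand-suc (suc i) (suc j)       = lowerBand-suc i j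

  lowerBand-diag : ∀ j → lowerBand j j ≡ b
  lowerBand-diag zero    = refl
  lowerBand-diag (suc j) = lowerBand-diag j

  lowerBand-sub : ∀ j → lowerBand (suc j) j ≡ a
  lowerBand-sub zero    = refl
  lowerBand-sub (suc j) = lowerBand-sub j

  lowerBand-off : ∀ i j → i ≢ j → i ≢ suc j → lowerBand i j ≡ + 0
  lowerBand-off zero          zero    i≢j _     = ⊥-elim (i≢j refl)
  lowerBand-off (suc zero)    zero    _   i≢j+1 = ⊥-elim (i≢j+1 refl)
  lowerBand-off (suc (suc i)) zero    _   _     = refl
  lowerBand-off zero          (suc j) _   _     = refl
  lowerBand-off (suc i)       (suc j) i≢j i≢j+1 = lowerBand-off i j (i≢j ∘ cong suc) (i≢j+1 ∘ cong suc)

  bordered : (ℕ → ℤ) → ℕ → ℕ → ℤ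
  bordered w i zero    = w i
  bordered w i (suc j) = lowerBand i j

  -- det of the size-k bordered matrix with first column w
  borderedDet : ℕ → (ℕ → ℤ) → ℤ
  borderedDet zero    w = + 0
  borderedDet (suc k) w = w 0 * a ^ k - b * borderedDet k (w ∘ suc)

  det-upperBand : ∀ m (A : Matrix m) → (∀ i j → A i j ≡ upperBand (toℕ i) (toℕ j)) → det m A ≡ a ^ m
  det-upperBand zero          A shape = refl
  det-upperBand (suc zero)    A shape = trans (det-size-one A) (trans (shape zero zero) (sym (*-identityʳ a)))
  det-upperBand (suc (suc m)) A shape = begin
    det (suc (suc m)) A
      ≡⟨ det-first-row-two m A (λ j → shape zero (suc (suc j))) ⟩
    A zero zero * det (suc m) (minor₀ A zero) - A zero (suc zero) * det (suc m) (minor₀ A (suc zero))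
      ≡⟨ cong₂ (λ α β → α * β - A zero (suc zero) * det (suc m) (minor₀ A (suc zero))) (shape zero zero)
               (det-upperBand (suc m) (minor₀ A zero) (λ r k → shape (suc r) (suc k))) ⟩
    a * a ^ suc m - A zero (suc zero) * det (suc m) (minor₀ A (suc zero))
      ≡⟨ cong (λ z → a * a ^ suc m - A zero (suc zero) * z)
              (det-zero-col (suc m) (minor₀ A (suc zero)) zero (λ r → shape (suc r) zero)) ⟩
    a * a ^ suc m - A zero (suc zero) * + 0
      ≡⟨ drop (a * a ^ suc m) (A zero (suc zero)) ⟩
    a ^ suc (suc m) ∎
    where
    open ≡-Reasoning
    drop : ∀ z y → z - y * + 0 ≡ z
    drop = solve-∀

  det-bordered : ∀ m (A : Matrix (suc m)) w → (∀ i j → A i j ≡ bordered w (toℕ i) (toℕ j)) →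
    det (suc m) A ≡ borderedDet (suc m) w
  det-bordered zero    A w shape = trans (det-size-one A) (trans (shape zero zero) (simplify (w 0) b))
    where
    simplify : ∀ w₀ b → w₀ ≡ w₀ * + 1 - b * + 0
    simplify = solve-∀
  det-bordered (suc m) A w shape = begin
    det (suc (suc m)) A
      ≡⟨ det-first-row-two m A (λ j → shape zero (suc (suc j))) ⟩
    A zero zero * det (suc m) (minor₀ A zero) - A zero (suc zero) * det (suc m) (minor₀ A (suc zero))
      ≡⟨ cong₂ _-_ (cong₂ _*_ (shape zero zero) (det-upperBand (suc m) (minor₀ A zero)
                      (λ r k → trans (shape (suc r) (suc k)) (lowerBand-suc (toℕ r) (toℕ k)))))
                   (cong₂ _*_ (shape zero (suc zero)) (det-bordered m (minor₀ A (suc zero)) (w ∘ suc) shape′)) ⟩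
    borderedDet (suc (suc m)) w ∎
    where
    open ≡-Reasoning
    shape′ : ∀ r k → minor₀ A (suc zero) r k ≡ bordered (w ∘ suc) (toℕ r) (toℕ k)
    shape′ r zero    = shape (suc r) zero
    shape′ r (suc k) = shape (suc r) (suc (suc k))

  borderedDet-combine : ∀ k (w w′ : ℕ → ℤ) (α β : ℤ) →
    α * borderedDet k w - β * borderedDet k w′ ≡ borderedDet k (λ r → α * w r - β * w′ r)
  borderedDet-combine zero    w w′ α β = vanish α β
    where
    vanish : ∀ α β → α * + 0 - β * + 0 ≡ + 0
    vanish = solve-∀
  borderedDet-combine (suc k) w w′ α β =
    trans (regroup α β (w 0) (w′ 0) (a ^ k) b (borderedDet k (w ∘ suc)) (borderedDet k (w′ ∘ suc)))
          (cong (λ z → (α * w 0 - β * w′ 0) * a ^ k - b * z) (borderedDet-combine k (w ∘ suc) (w′ ∘ suc) α β))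
    where
    regroup : ∀ α β w₀ w₀′ A b f f′ →
      α * (w₀ * A - b * f) - β * (w₀′ * A - b * f′) ≡ (α * w₀ - β * w₀′) * A - b * (α * f - β * f′)
    regroup = solve-∀

  -- Unfolding the recursion: the i-th summand comes from i-1 steps along
  -- the subdiagonal (factor a each) and k-i steps along the diagonal (-b each).
  borderedDet-closed : ∀ k (w : ℕ → ℤ) → borderedDet k w ≡ sum1to k (λ i → w (k ∸ i) * a ^ (i ∸ 1) * (- b) ^ (k ∸ i))
  borderedDet-closed zero    w = refl
  borderedDet-closed (suc k) w = begin
    w 0 * a ^ k - b * borderedDet k (w ∘ suc)
      ≡⟨ cong (λ z → w 0 * a ^ k - b * z) (borderedDet-closed k (w ∘ suc)) ⟩
    w 0 * a ^ k - b * sum1to k term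
      ≡⟨ cong (λ z → w 0 * a ^ k + z) (trans (neg-mul b (sum1to k term)) (sym (sum1to-*ˡ k (- b) term))) ⟩
    w 0 * a ^ k + sum1to k (λ i → - b * term i)
      ≡⟨ cong (λ z → w 0 * a ^ k + z) (sum1to-cong k _ _ (λ i i<k →
           trans (regroup (- b) (w (suc (k ∸ suc i))) (a ^ i) ((- b) ^ (k ∸ suc i)))
                 (cong (λ z → w z * a ^ i * (- b) ^ z) (sym (ℕP.+-∸-assoc 1 i<k))))) ⟩
    w 0 * a ^ k + sum1to k term′
      ≡⟨ trans (+-comm (w 0 * a ^ k) (sum1to k term′))
               (cong (_+_ (sum1to k term′)) (trans (sym (*-identityʳ (w 0 * a ^ k)))
                  (cong (λ z → w z * a ^ k * (- b) ^ z) (sym (ℕP.n∸n≡0 k))))) ⟩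
    sum1to (suc k) term′ ∎
    where
    open ≡-Reasoning
    term term′ : ℕ → ℤ
    term  i = w (suc (k ∸ i)) * a ^ (i ∸ 1) * (- b) ^ (k ∸ i)
    term′ i = w (suc k ∸ i) * a ^ (i ∸ 1) * (- b) ^ (suc k ∸ i)
    neg-mul : ∀ b s → - (b * s) ≡ - b * s
    neg-mul = solve-∀
    regroup : ∀ B w A P → B * (w * A * P) ≡ w * A * (B * P)
    regroup = solve-∀

  -- The shape reached from the circulant after column operations: first two
  -- columns u, v, then a zero top row above lowerBand.
  reduced : (ℕ → ℤ) → (ℕ → ℤ) → ℕ → ℕ → ℤ
  reduced u v i       zero          = u i
  reduced u v i       (suc zero)    = v i
  reduced u v zero    (suc (suc j)) = + 0
  reduced u v (suc i) (suc (suc j)) = lowerBand i j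

  det-reduced : ∀ m (A : Matrix (suc (suc m))) u v → (∀ i j → A i j ≡ reduced u v (toℕ i) (toℕ j)) →
    det (suc (suc m)) A ≡ u 0 * borderedDet (suc m) (v ∘ suc) - v 0 * borderedDet (suc m) (u ∘ suc)
  det-reduced m A u v shape =
    trans (det-first-row-two m A (λ j → shape zero (suc (suc j))))
          (cong₂ _-_ (cong₂ _*_ (shape zero zero) (det-bordered m (minor₀ A zero) (v ∘ suc) shape₀))
                     (cong₂ _*_ (shape zero (suc zero)) (det-bordered m (minor₀ A (suc zero)) (u ∘ suc) shape₁)))
    where
    shape₀ : ∀ r k → minor₀ A zero r k ≡ bordered (v ∘ suc) (toℕ r) (toℕ k)
    shape₀ r zero    = shape (suc r) (suc zero)
    shape₀ r (suc k) = shape (suc r) (suc (suc k))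
    shape₁ : ∀ r k → minor₀ A (suc zero) r k ≡ bordered (u ∘ suc) (toℕ r) (toℕ k)
    shape₁ r zero    = shape (suc r) zero
    shape₁ r (suc k) = shape (suc r) (suc (suc k))

-- For x with x_{m+2} = p x_{m+1} + q x_m, subtracting p·(column j-1) and
-- q·(column j-2) from every column j ≥ 2 of C_{n,1}(x) kills all entries
-- of that column except two.  The columns are processed from left to
-- right: in `partial t` the columns j ≥ t have already been reduced.
module ColumnReduction (x : ℕ → ℤ) (p q : ℤ) (rec : ∀ m → x (suc (suc m)) ≡ p * x (suc m) + q * x m) (n : ℕ) where

  entry : ℕ → ℕ → ℤ
  entry i j = x (suc (cyclicDiff n i j))

  reducedEntry : ℕ → ℕ → ℤ
  reducedEntry i j = entry i j - p * entry i (j ∸ 1) - q * entry i (j ∸ 2)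

  partialℕ : ℕ → ℕ → ℕ → ℤ
  partialℕ t i j with j ℕ.<? t
  ... | yes _ = entry i j
  ... | no  _ = reducedEntry i j

  partial : ℕ → Matrix n
  partial t i j = partialℕ t (toℕ i) (toℕ j)

  partial-< : ∀ t i j → j ℕ.< t → partialℕ t i j ≡ entry i j
  partial-< t i j j<t with j ℕ.<? t
  ... | yes _   = refl
  ... | no  j≮t = ⊥-elim (j≮t j<t)

  partial-≥ : ∀ t i j → ¬ (j ℕ.< t) → partialℕ t i j ≡ reducedEntry i j
  partial-≥ t i j j≮t with j ℕ.<? t
  ... | yes j<t = ⊥-elim (j≮t j<t)
  ... | no  _   = refl

  partial-off : ∀ t i j → j ≢ t → partialℕ t i j ≡ partialℕ (suc t) i j
  partial-off t i j j≢t with j ℕ.<? t | j ℕ.<? suc t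
  ... | yes _   | yes _         = refl
  ... | no  _   | no  _         = refl
  ... | yes j<t | no  j≮t+1     = ⊥-elim (j≮t+1 (ℕP.m≤n⇒m≤1+n j<t))
  ... | no  j≮t | yes (s≤s j≤t) = ⊥-elim (j≢t (ℕP.≤-antisym j≤t (ℕP.≮⇒≥ j≮t)))

  reduce-step : ∀ t′ → suc (suc t′) ℕ.< n → det n (partial (suc (suc t′))) ≡ det n (partial (suc (suc (suc t′))))
  reduce-step t′ t<n = trans second first
    where
    t = suc (suc t′)
    c c₁ c₂ : Fin n
    c  = fromℕ< t<n
    c₁ = fromℕ< (ℕP.<-trans (ℕP.n<1+n (suc t′)) t<n)
    c₂ = fromℕ< (ℕP.<-trans (ℕP.n<1+n t′) (ℕP.<-trans (ℕP.n<1+n (suc t′)) t<n))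
    c≢c₁ : c ≢ c₁
    c≢c₁ eq = ℕP.<-irrefl (trans (sym (toℕ-fromℕ< _)) (trans (cong toℕ (sym eq)) (toℕ-fromℕ< _))) (ℕP.n<1+n (suc t′))
    c≢c₂ : c ≢ c₂
    c≢c₂ eq = ℕP.<-irrefl (trans (sym (toℕ-fromℕ< _)) (trans (cong toℕ (sym eq)) (toℕ-fromℕ< _)))
                (ℕP.<-trans (ℕP.n<1+n t′) (ℕP.n<1+n (suc t′)))
    B : Matrix n
    B = partial (suc t)
    col : ∀ {k} (ck : Fin n) → toℕ ck ≡ k → k ℕ.< suc t → ∀ i → B i ck ≡ entry (toℕ i) k
    col ck refl k<t+1 i = partial-< (suc t) (toℕ i) (toℕ ck) k<t+1
    B₁ : Matrix n
    B₁ = setCol B c (λ i → B i c + - p * B i c₁)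
    first : det n B₁ ≡ det n B
    first = det-add-col-multiple n B B₁ c c₁ c≢c₁ (- p) (setCol-off B c _) (setCol-at B c _)
    second : det n (partial t) ≡ det n B₁
    second = det-add-col-multiple n B₁ (partial t) c c₂ c≢c₂ (- q)
      (λ i j j≢c → trans (partial-off t (toℕ i) (toℕ j) (λ eq → j≢c (toℕ-injective (trans eq (sym (toℕ-fromℕ< t<n))))))
                         (sym (setCol-off B c _ i j j≢c)))
      (λ i → begin
        partial t i c                  ≡⟨ trans (cong (partialℕ t (toℕ i)) (toℕ-fromℕ< t<n)) (partial-≥ t (toℕ i) t (ℕP.<-irrefl refl)) ⟩
        reducedEntry (toℕ i) t         ≡⟨ distribute (entry (toℕ i) t) (entry (toℕ i) (suc t′)) (entry (toℕ i) t′) p q ⟩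
        entry (toℕ i) t + - p * entry (toℕ i) (suc t′) + - q * entry (toℕ i) t′
          ≡⟨ sym (cong₂ (λ α β → α + - q * β)
                   (trans (setCol-at B c _ i) (cong₂ (λ α β → α + - p * β)
                      (col c (toℕ-fromℕ< t<n) (ℕP.n<1+n t) i)
                      (col c₁ (toℕ-fromℕ< _) (ℕP.<-trans (ℕP.n<1+n (suc t′)) (ℕP.n<1+n t)) i)))
                   (trans (setCol-off B c _ i c₂ (c≢c₂ ∘ sym))
                      (col c₂ (toℕ-fromℕ< _) (ℕP.<-trans (ℕP.n<1+n t′) (ℕP.<-trans (ℕP.n<1+n (suc t′)) (ℕP.n<1+n t))) i))) ⟩
        B₁ i c + - q * B₁ i c₂         ∎)
      where
      open ≡-Reasoning
      distribute : ∀ e e₁ e₂ p q → e - p * e₁ - q * e₂ ≡ e + - p * e₁ + - q * e₂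
      distribute = solve-∀

  reduce-all : ∀ d t → t ℕ.+ d ≡ n → 2 ≤ t → det n (partial t) ≡ det n (circulant n x)
  reduce-all zero          t t≡n _ = det-cong n (λ i j → partial-< t (toℕ i) (toℕ j)
                                        (subst (toℕ j ℕ.<_) (sym (trans (sym (ℕP.+-identityʳ t)) t≡n)) (toℕ<n j)))
  reduce-all (suc d) (suc zero)          _   (s≤s ())
  reduce-all (suc d) (suc (suc t′)) t+d≡n 2≤t =
    trans (reduce-step t′ t<n) (reduce-all d (suc (suc (suc t′))) (trans (sym (ℕP.+-suc (suc (suc t′)) d)) t+d≡n) (ℕP.m≤n⇒m≤1+n 2≤t))
    where
    t<n : suc (suc t′) ℕ.< n
    t<n = subst (suc (suc t′) ℕ.<_) t+d≡n (ℕP.m<m+n (suc (suc t′)) (s≤s z≤n))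

-- For n = m + 2, the fully reduced circulant has the `reduced` band shape
-- with a = x₁ - p xₙ - q xₙ₋₁ (below the diagonal) and b = x₂ - p x₁ - q xₙ
-- (on it), so its determinant is a combination of two bordered determinants.
module CirculantDeterminant (x : ℕ → ℤ) (p q : ℤ) (rec : ∀ m → x (suc (suc m)) ≡ p * x (suc m) + q * x m) (m : ℕ) where

  n : ℕ
  n = suc (suc m)

  open ColumnReduction x p q rec n

  a b : ℤ
  a = x 1 - p * x n - q * x (suc m)
  b = x 2 - p * x 1 - q * x n

  open Band a b

  u v : ℕ → ℤ
  u i = entry i 0
  v i = entry i 1

  partial₂-reduced : ∀ i j → i ℕ.< n → partialℕ 2 i j ≡ reduced u v i j
  partial₂-reduced i zero          _   = partial-< 2 i 0 (s≤s z≤n)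
  partial₂-reduced i (suc zero)    _   = partial-< 2 i 1 (s≤s (s≤s z≤n))
  partial₂-reduced i (suc (suc j)) i<n =
    trans (partial-≥ 2 i (suc (suc j)) (λ { (s≤s (s≤s ())) })) (byRow (i ℕ.≟ suc j) (i ℕ.≟ suc (suc j)))
    where
    reducedAt : ℕ → ℕ → ℕ → ℤ
    reducedAt α β γ = x (suc α) - p * x (suc β) - q * x (suc γ)
    byRow : Dec (i ≡ suc j) → Dec (i ≡ suc (suc j)) → reducedEntry i (suc (suc j)) ≡ reduced u v i (suc (suc j))
    byRow (yes refl) _ = begin
      reducedAt (cyclicDiff n (suc j) (suc (suc j))) (cyclicDiff n (suc j) (suc j)) (cyclicDiff n (suc j) j)
        ≡⟨ cong₂ (λ α γ → reducedAt α (cyclicDiff n (suc j) (suc j)) γ)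
                 (trans (cyclicDiff-suc n (suc j) (suc j) i<n (λ e → ℕP.<-irrefl (sym e) (ℕP.n<1+n (suc j))))
                        (cong suc (cyclicDiff-self n (suc j))))
                 (cyclicDiff-behind n 1 j (s≤s z≤n)) ⟩
      reducedAt 1 (cyclicDiff n (suc j) (suc j)) (suc m)
        ≡⟨ cong (λ β → reducedAt 1 β (suc m)) (cyclicDiff-self n (suc j)) ⟩
      b ≡⟨ sym (lowerBand-diag j) ⟩
      lowerBand j j ∎
      where open ≡-Reasoning
    byRow (no _) (yes refl) = begin
      reducedAt (cyclicDiff n (suc (suc j)) (suc (suc j))) (cyclicDiff n (suc (suc j)) (suc j)) (cyclicDiff n (suc (suc j)) j)
        ≡⟨ cong₂ (λ α γ → reducedAt α (cyclicDiff n (suc (suc j)) (suc j)) γ)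
                 (cyclicDiff-self n (suc (suc j))) (cyclicDiff-behind n 2 j (s≤s z≤n)) ⟩
      reducedAt 0 (cyclicDiff n (suc (suc j)) (suc j)) m
        ≡⟨ cong (λ β → reducedAt 0 β m) (cyclicDiff-behind n 1 (suc j) (s≤s z≤n)) ⟩
      a ≡⟨ sym (lowerBand-sub j) ⟩
      lowerBand (suc j) j ∎
      where open ≡-Reasoning
    -- elsewhere the three entries are consecutive terms x_{k+3}, x_{k+2}, x_{k+1}
    byRow (no i≢j+1) (no i≢j+2) = begin
      reducedAt (cyclicDiff n i (suc (suc j))) (cyclicDiff n i (suc j)) k
        ≡⟨ cong₂ (λ α β → reducedAt α β k) shift₂ shift₁ ⟩
      reducedAt (suc (suc k)) (suc k) k
        ≡⟨ cong (λ z → z - p * x (suc (suc k)) - q * x (suc k)) (rec (suc k)) ⟩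
      p * x (suc (suc k)) + q * x (suc k) - p * x (suc (suc k)) - q * x (suc k)
        ≡⟨ cancel (p * x (suc (suc k))) (q * x (suc k)) ⟩
      + 0 ≡⟨ sym (offBand i i<n i≢j+1 i≢j+2) ⟩
      reduced u v i (suc (suc j)) ∎
      where
      open ≡-Reasoning
      k = cyclicDiff n i j
      shift₁ : cyclicDiff n i (suc j) ≡ suc k
      shift₁ = cyclicDiff-suc n i j i<n (i≢j+1 ∘ sym)
      shift₂ : cyclicDiff n i (suc (suc j)) ≡ suc (suc k)
      shift₂ = trans (cyclicDiff-suc n i (suc j) i<n (i≢j+2 ∘ sym)) (cong suc shift₁)
      cancel : ∀ α β → α + β - α - β ≡ + 0
      cancel = solve-∀
      offBand : ∀ i → i ℕ.< n → i ≢ suc j → i ≢ suc (suc j) → reduced u v i (suc (suc j)) ≡ + 0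
      offBand zero     _ _      _      = refl
      offBand (suc i′) _ i≢j+1′ i≢j+2′ = lowerBand-off i′ j (i≢j+1′ ∘ cong suc) (i≢j+2′ ∘ cong suc)

  det-circulant : det n (circulant n x) ≡ u 0 * borderedDet (suc m) (v ∘ suc) - v 0 * borderedDet (suc m) (u ∘ suc)
  det-circulant = trans (sym (reduce-all m 2 refl (s≤s (s≤s z≤n))))
                        (det-reduced m (partial 2) u v (λ i j → partial₂-reduced (toℕ i) (toℕ j) (toℕ<n i)))

  W : ℕ → ℤ
  W r = x 1 * v (suc r) - x 2 * u (suc r)

  det-circulant-closed : det n (circulant n x) ≡ sum1to (suc m) (λ i → W (suc m ∸ i) * a ^ (i ∸ 1) * (- b) ^ (suc m ∸ i))
  det-circulant-closed =
    trans det-circulant (trans (borderedDet-combine (suc m) (v ∘ suc) (u ∘ suc) (x 1) (x 2)) (borderedDet-closed (suc m) W))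

  W-first : W 0 ≡ x 1 * x 1 - x 2 * x n
  W-first = cong (λ k → x 1 * x 1 - x 2 * x (suc k)) (cyclicDiff-behind n 1 0 (s≤s z≤n))

  W-later : ∀ r i → r ℕ.+ suc i ≡ m → W (suc r) ≡ x 1 * x (suc i ℕ.+ 2) - x 2 * x (suc i ℕ.+ 1)
  W-later r i r+i+1≡m = cong₂ (λ α β → x 1 * x α - x 2 * x β)
    (trans (cong suc (trans (cyclicDiff-suc n (suc (suc r)) 0 (s≤s (s≤s r<m)) (λ ())) (cong suc col₀)))
           (ℕP.+-comm 2 (suc i)))
    (trans (cong suc col₀) (ℕP.+-comm 1 (suc i)))
    where
    r<m : suc r ≤ m
    r<m = ℕP.m+n≤o⇒m≤o (suc r) (ℕP.≤-reflexive (trans (sym (ℕP.+-suc r i)) r+i+1≡m))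
    col₀ : cyclicDiff n (suc (suc r)) 0 ≡ suc i
    col₀ = trans (cong (λ k → cyclicDiff n k 0) (sym (ℕP.+-identityʳ (suc (suc r)))))
                 (trans (cyclicDiff-behind n (suc (suc r)) 0 (s≤s z≤n))
                        (trans (cong (_∸ r) (sym r+i+1≡m)) (ℕP.m+n∸m≡n r (suc i))))

module Recurrence (x : ℕ → ℤ) (p q : ℤ) (rec : ∀ m → x (suc (suc m)) ≡ p * x (suc m) + q * x m) where

  α β : ℕ → ℤ
  α n = x 1 - x (n ℕ.+ 1)
  β n = q * x n + p * x 1 - x 2

  coefficient : ℕ → ℤ
  coefficient i = x 1 * x (i ℕ.+ 2) - x 2 * x (i ℕ.+ 1)

  circulantFormula : ℕ → ℤ
  circulantFormula n = x 1 * α n ^ (n ∸ 1) + sum1to (n ∸ 1) (λ i → coefficient i * α n ^ (i ∸ 1) * β n ^ (n ∸ 1 ∸ i))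

  coefficient-rec : ∀ i → coefficient i ≡ (x 1 * p - x 2) * x (suc i) + x 1 * q * x i
  coefficient-rec i = begin
    x 1 * x (i ℕ.+ 2) - x 2 * x (i ℕ.+ 1)
      ≡⟨ cong₂ (λ k l → x 1 * x k - x 2 * x l) (ℕP.+-comm i 2) (ℕP.+-comm i 1) ⟩
    x 1 * x (suc (suc i)) - x 2 * x (suc i)
      ≡⟨ cong (λ z → x 1 * z - x 2 * x (suc i)) (rec i) ⟩
    x 1 * (p * x (suc i) + q * x i) - x 2 * x (suc i)
      ≡⟨ regroup (x 1) (x 2) p q (x (suc i)) (x i) ⟩
    (x 1 * p - x 2) * x (suc i) + x 1 * q * x i ∎
    where
    open ≡-Reasoning
    regroup : ∀ x₁ x₂ p q y z → x₁ * (p * y + q * z) - x₂ * y ≡ (x₁ * p - x₂) * y + x₁ * q * z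
    regroup = solve-∀

  det-circulant-formula : ∀ m → det (suc (suc m)) (circulant (suc (suc m)) x) ≡ circulantFormula (suc (suc m))
  det-circulant-formula m = begin
    det n (circulant n x)
      ≡⟨ det-circulant-closed ⟩
    sum1to (suc m) (λ i → W (suc m ∸ i) * a ^ (i ∸ 1) * (- b) ^ (suc m ∸ i))
      ≡⟨ cong₂ (λ A B → sum1to (suc m) (λ i → W (suc m ∸ i) * A ^ (i ∸ 1) * B ^ (suc m ∸ i))) a≡α -b≡β ⟩
    sum1to m closed + closed (suc m)
      ≡⟨ cong₂ _+_ (sum1to-cong m closed term middle) last ⟩
    sum1to m term + (x 1 * α n ^ suc m + term (suc m))
      ≡⟨ exchange (sum1to m term) (x 1 * α n ^ suc m) (term (suc m)) ⟩
    circulantFormula n ∎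
    where
    open ≡-Reasoning
    open CirculantDeterminant x p q rec m
    closed term : ℕ → ℤ
    closed i = W (suc m ∸ i) * α n ^ (i ∸ 1) * β n ^ (suc m ∸ i)
    term   i = coefficient i * α n ^ (i ∸ 1) * β n ^ (suc m ∸ i)
    n+1≡ : n ℕ.+ 1 ≡ suc n
    n+1≡ = ℕP.+-comm n 1
    a≡α : a ≡ α n
    a≡α = trans (regroup (x 1) (p * x n) (q * x (suc m))) (cong (λ z → x 1 - z) (sym (trans (cong x n+1≡) (rec (suc m)))))
      where
      regroup : ∀ x₁ y z → x₁ - y - z ≡ x₁ - (y + z)
      regroup = solve-∀
    -b≡β : - b ≡ β n
    -b≡β = regroup (x 1) (x 2) (x n) p q
      where
      regroup : ∀ x₁ x₂ xₙ p q → - (x₂ - p * x₁ - q * xₙ) ≡ q * xₙ + p * x₁ - x₂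
      regroup = solve-∀
    middle : ∀ i → suc i ≤ m → closed (suc i) ≡ term (suc i)
    middle i i<m = cong (λ c → c * α n ^ i * β n ^ (m ∸ i))
      (trans (cong W (ℕP.+-∸-assoc 1 i<m)) (W-later (m ∸ suc i) i (ℕP.m∸n+n≡m i<m)))
    last : closed (suc m) ≡ x 1 * α n ^ suc m + term (suc m)
    last = begin
      W (m ∸ m) * α n ^ m * β n ^ (m ∸ m)
        ≡⟨ cong (λ k → W k * α n ^ m * β n ^ k) (ℕP.n∸n≡0 m) ⟩
      W 0 * α n ^ m * + 1
        ≡⟨ cong (λ z → z * α n ^ m * + 1) W-first ⟩
      (x 1 * x 1 - x 2 * x n) * α n ^ m * + 1
        ≡⟨ split (x 1) (x 2) (x (n ℕ.+ 1)) (x n) (α n ^ m) ⟩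
      x 1 * ((x 1 - x (n ℕ.+ 1)) * α n ^ m) + (x 1 * x (n ℕ.+ 1) - x 2 * x n) * α n ^ m * + 1
        ≡⟨ cong₂ (λ k l → x 1 * α n ^ suc m + (x 1 * x k - x 2 * x l) * α n ^ m * β n ^ 0)
                 (trans n+1≡ (sym (ℕP.+-comm (suc m) 2))) (sym (ℕP.+-comm (suc m) 1)) ⟩
      x 1 * α n ^ suc m + coefficient (suc m) * α n ^ m * β n ^ 0
        ≡⟨ cong (λ k → x 1 * α n ^ suc m + coefficient (suc m) * α n ^ m * β n ^ k) (sym (ℕP.n∸n≡0 m)) ⟩
      x 1 * α n ^ suc m + term (suc m) ∎
      where
      split : ∀ x₁ x₂ X Y P → (x₁ * x₁ - x₂ * Y) * P * + 1 ≡ x₁ * ((x₁ - X) * P) + (x₁ * X - x₂ * Y) * P * + 1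
      split = solve-∀
    exchange : ∀ s l t → s + (l + t) ≡ l + (s + t)
    exchange = solve-∀

  det-Cg-formula : ∀ n g → 2 ≤ n → det n (Cg n g x) ≡ det n (Qg n g) * circulantFormula n
  det-Cg-formula (suc (suc m)) g (s≤s (s≤s z≤n)) =
    trans (det-Cg (suc m) g x) (cong (det (suc (suc m)) (Qg (suc (suc m)) g) *_) (det-circulant-formula m))

  formula-normalised : x 1 ≡ + 1 → ∀ n (t : ℕ → ℤ) →
    (∀ i → suc i ≤ n ∸ 1 → coefficient (suc i) * α n ^ i * β n ^ (n ∸ 1 ∸ suc i) ≡ t (suc i)) →
    circulantFormula n ≡ α n ^ (n ∸ 1) + sum1to (n ∸ 1) t
  formula-normalised x₁≡1 n t termwise =
    cong₂ _+_ (trans (cong (_* α n ^ (n ∸ 1)) x₁≡1) (*-identityˡ (α n ^ (n ∸ 1))))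
              (sum1to-cong (n ∸ 1) _ t termwise)

^-distribʳ-* : ∀ (a b : ℤ) k → (a * b) ^ k ≡ a ^ k * b ^ k
^-distribʳ-* a b zero    = refl
^-distribʳ-* a b (suc k) = trans (cong (a * b *_) (^-distribʳ-* a b k)) (regroup a b (a ^ k) (b ^ k))
  where
  regroup : ∀ a b c d → a * b * (c * d) ≡ a * c * (b * d)
  regroup = solve-∀

fibonacci-circulant : ∀ n g → 2 ≤ n → det n (Cg n g fib) ≡ det n (Qg n g) *
  ((+ 1 - fib (n ℕ.+ 1)) ^ (n ∸ 1) + sum1to (n ∸ 1) (λ i → fib i * (+ 1 - fib (n ℕ.+ 1)) ^ (i ∸ 1) * fib n ^ (n ∸ 1 ∸ i)))
fibonacci-circulant n g 2≤n =
  trans (det-Cg-formula n g 2≤n) (cong (det n (Qg n g) *_) (formula-normalised refl n _ termwise))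
  where
  rec : ∀ m → fib (suc (suc m)) ≡ + 1 * fib (suc m) + + 1 * fib m
  rec m = unit (fib (suc m)) (fib m)
    where
    unit : ∀ y z → y + z ≡ + 1 * y + + 1 * z
    unit = solve-∀
  open Recurrence fib (+ 1) (+ 1) rec
  -- F_{i+2} - F_{i+1} = F_i  and  β = Fₙ
  termwise : ∀ i → suc i ≤ n ∸ 1 →
    coefficient (suc i) * α n ^ i * β n ^ (n ∸ 1 ∸ suc i) ≡ fib (suc i) * α n ^ i * fib n ^ (n ∸ 1 ∸ suc i)
  termwise i _ = cong₂ (λ c B → c * α n ^ i * B ^ (n ∸ 1 ∸ suc i))
    (trans (coefficient-rec (suc i)) (simplify (fib (suc (suc i))) (fib (suc i)))) (simplifyβ (fib n))
    where
    simplify : ∀ y z → (+ 1 * + 1 - + 1) * y + + 1 * + 1 * z ≡ z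
    simplify = solve-∀
    simplifyβ : ∀ X → + 1 * X + + 1 * + 1 - + 1 ≡ X
    simplifyβ = solve-∀

lucas-circulant : ∀ n g → 2 ≤ n → det n (Cg n g lucas) ≡ det n (Qg n g) *
  ((+ 1 - lucas (n ℕ.+ 1)) ^ (n ∸ 1) + sum1to (n ∸ 1) (λ i → (lucas (i ℕ.+ 2) - + 3 * lucas (i ℕ.+ 1))
                                                            * (+ 1 - lucas (n ℕ.+ 1)) ^ (i ∸ 1) * (lucas n - + 2) ^ (n ∸ 1 ∸ i)))
lucas-circulant n g 2≤n =
  trans (det-Cg-formula n g 2≤n) (cong (det n (Qg n g) *_) (formula-normalised refl n _ termwise))
  where
  rec : ∀ m → lucas (suc (suc m)) ≡ + 1 * lucas (suc m) + + 1 * lucas m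
  rec m = unit (lucas (suc m)) (lucas m)
    where
    unit : ∀ y z → y + z ≡ + 1 * y + + 1 * z
    unit = solve-∀
  open Recurrence lucas (+ 1) (+ 1) rec
  -- here the coefficient is already L_{i+2} - 3 L_{i+1}, and β = Lₙ - 2
  termwise : ∀ i → suc i ≤ n ∸ 1 →
    coefficient (suc i) * α n ^ i * β n ^ (n ∸ 1 ∸ suc i)
      ≡ (lucas (suc i ℕ.+ 2) - + 3 * lucas (suc i ℕ.+ 1)) * α n ^ i * (lucas n - + 2) ^ (n ∸ 1 ∸ suc i)
  termwise i _ = cong₂ (λ c B → c * α n ^ i * B ^ (n ∸ 1 ∸ suc i))
    (simplify (lucas (suc i ℕ.+ 2)) (lucas (suc i ℕ.+ 1))) (simplifyβ (lucas n))
    where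
    simplify : ∀ y z → + 1 * y - + 3 * z ≡ y - + 3 * z
    simplify = solve-∀
    simplifyβ : ∀ X → + 1 * X + + 1 * + 1 - + 3 ≡ X - + 2
    simplifyβ = solve-∀

pell-circulant : ∀ n g → 2 ≤ n → det n (Cg n g pell) ≡ det n (Qg n g) *
  ((+ 1 - pell (n ℕ.+ 1)) ^ (n ∸ 1) + sum1to (n ∸ 1) (λ i → pell i * (+ 1 - pell (n ℕ.+ 1)) ^ (i ∸ 1) * pell n ^ (n ∸ 1 ∸ i)))
pell-circulant n g 2≤n =
  trans (det-Cg-formula n g 2≤n) (cong (det n (Qg n g) *_) (formula-normalised refl n _ termwise))
  where
  rec : ∀ m → pell (suc (suc m)) ≡ + 2 * pell (suc m) + + 1 * pell m
  rec m = unit (pell (suc m)) (pell m)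
    where
    unit : ∀ y z → + 2 * y + z ≡ + 2 * y + + 1 * z
    unit = solve-∀
  open Recurrence pell (+ 2) (+ 1) rec
  -- P_{i+2} - 2 P_{i+1} = P_i  and  β = Pₙ
  termwise : ∀ i → suc i ≤ n ∸ 1 →
    coefficient (suc i) * α n ^ i * β n ^ (n ∸ 1 ∸ suc i) ≡ pell (suc i) * α n ^ i * pell n ^ (n ∸ 1 ∸ suc i)
  termwise i _ = cong₂ (λ c B → c * α n ^ i * B ^ (n ∸ 1 ∸ suc i))
    (trans (coefficient-rec (suc i)) (simplify (pell (suc (suc i))) (pell (suc i)))) (simplifyβ (pell n))
    where
    simplify : ∀ y z → (+ 1 * + 2 - + 2) * y + + 1 * + 1 * z ≡ z
    simplify = solve-∀
    simplifyβ : ∀ X → + 1 * X + + 2 * + 1 - + 2 ≡ X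
    simplifyβ = solve-∀

jacobsthal-circulant : ∀ n g → 2 ≤ n → det n (Cg n g jacobsthal) ≡ det n (Qg n g) *
  ((+ 1 - jacobsthal (n ℕ.+ 1)) ^ (n ∸ 1) + sum1to (n ∸ 1) (λ i → jacobsthal i * (+ 1 - jacobsthal (n ℕ.+ 1)) ^ (i ∸ 1)
                                                                 * (+ 2) ^ (n ∸ i) * jacobsthal n ^ (n ∸ 1 ∸ i)))
jacobsthal-circulant n g 2≤n =
  trans (det-Cg-formula n g 2≤n) (cong (det n (Qg n g) *_) (formula-normalised refl n _ termwise))
  where
  rec : ∀ m → jacobsthal (suc (suc m)) ≡ + 1 * jacobsthal (suc m) + + 2 * jacobsthal m
  rec m = unit (jacobsthal (suc m)) (jacobsthal m)
    where
    unit : ∀ y z → y + + 2 * z ≡ + 1 * y + + 2 * z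
    unit = solve-∀
  open Recurrence jacobsthal (+ 1) (+ 2) rec
  -- J_{i+2} - J_{i+1} = 2 J_i  and  β = 2 Jₙ; the two factors 2 merge into 2ⁿ⁻ⁱ
  termwise : ∀ i → suc i ≤ n ∸ 1 →
    coefficient (suc i) * α n ^ i * β n ^ (n ∸ 1 ∸ suc i)
      ≡ jacobsthal (suc i) * α n ^ i * (+ 2) ^ (n ∸ suc i) * jacobsthal n ^ (n ∸ 1 ∸ suc i)
  termwise i i<n-1 = begin
    coefficient (suc i) * α n ^ i * β n ^ k
      ≡⟨ cong₂ (λ c B → c * α n ^ i * B ^ k)
               (trans (coefficient-rec (suc i)) (simplify (jacobsthal (suc (suc i))) (jacobsthal (suc i))))
               (simplifyβ (jacobsthal n)) ⟩
    + 2 * jacobsthal (suc i) * α n ^ i * (+ 2 * jacobsthal n) ^ k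
      ≡⟨ cong (+ 2 * jacobsthal (suc i) * α n ^ i *_) (^-distribʳ-* (+ 2) (jacobsthal n) k) ⟩
    + 2 * jacobsthal (suc i) * α n ^ i * ((+ 2) ^ k * jacobsthal n ^ k)
      ≡⟨ regroup (jacobsthal (suc i)) (α n ^ i) ((+ 2) ^ k) (jacobsthal n ^ k) ⟩
    jacobsthal (suc i) * α n ^ i * (+ 2) ^ suc k * jacobsthal n ^ k
      ≡⟨ cong (λ e → jacobsthal (suc i) * α n ^ i * (+ 2) ^ e * jacobsthal n ^ k) (sym n-i≡k+1) ⟩
    jacobsthal (suc i) * α n ^ i * (+ 2) ^ (n ∸ suc i) * jacobsthal n ^ k ∎
    where
    open ≡-Reasoning
    k : ℕ
    k = n ∸ 1 ∸ suc i
    n-i≡k+1 : n ∸ suc i ≡ suc k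
    n-i≡k+1 = trans (sym (ℕP.∸-+-assoc n 1 i)) (ℕP.+-∸-assoc 1 i<n-1)
    simplify : ∀ y z → (+ 1 * + 1 - + 1) * y + + 1 * + 2 * z ≡ + 2 * z
    simplify = solve-∀
    simplifyβ : ∀ X → + 2 * X + + 1 * + 1 - + 1 ≡ + 2 * X
    simplifyβ = solve-∀
    regroup : ∀ J A T S → + 2 * J * A * (T * S) ≡ J * A * (+ 2 * T) * S
    regroup = solve-∀

-- Corollary 2

corollary2 : (n g : ℕ) → 2 ≤ n → gcd n g ≡ 1 →
    (det n (Cg n g fib) ≡ det n (Qg n g) *
       ((+ 1 - fib (n Data.Nat.+ 1)) ^ (n ∸ 1)
        + sum1to (n ∸ 1) (λ i → fib i * (+ 1 - fib (n Data.Nat.+ 1)) ^ (i ∸ 1) * fib n ^ (n ∸ 1 ∸ i))))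
    × (det n (Cg n g lucas) ≡ det n (Qg n g) *
       ((+ 1 - lucas (n Data.Nat.+ 1)) ^ (n ∸ 1)
        + sum1to (n ∸ 1) (λ i → (lucas (i Data.Nat.+ 2) - + 3 * lucas (i Data.Nat.+ 1))
                                 * (+ 1 - lucas (n Data.Nat.+ 1)) ^ (i ∸ 1) * (lucas n - + 2) ^ (n ∸ 1 ∸ i))))
    × (det n (Cg n g pell) ≡ det n (Qg n g) *
       ((+ 1 - pell (n Data.Nat.+ 1)) ^ (n ∸ 1)
        + sum1to (n ∸ 1) (λ i → pell i * (+ 1 - pell (n Data.Nat.+ 1)) ^ (i ∸ 1) * pell n ^ (n ∸ 1 ∸ i))))
    × (det n (Cg n g jacobsthal) ≡ det n (Qg n g) *
       ((+ 1 - jacobsthal (n Data.Nat.+ 1)) ^ (n ∸ 1)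
        + sum1to (n ∸ 1) (λ i → jacobsthal i * (+ 1 - jacobsthal (n Data.Nat.+ 1)) ^ (i ∸ 1)
                                 * (+ 2) ^ (n ∸ i) * jacobsthal n ^ (n ∸ 1 ∸ i))))
corollary2 n g 2≤n _ =
  fibonacci-circulant n g 2≤n , lucas-circulant n g 2≤n , pell-circulant n g 2≤n , jacobsthal-circulant n g 2≤n
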